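{- Let $n \geq 9$ be an integer that is not prime. Then there exists a nut graph $G$ of order $n$ with $o_v(G) = 2$.
   Context: A nut graph is a simple connected graph whose adjacency matrix has one-dimensional kernel spanned by a vector with no zero entry. $o_v(G)$ is the number of orbits of the full automorphism group $\mathrm{Aut}(G)$ on $V(G)$. -}

module Defs where

open import Data.Nat using (ℕ; zero; suc)
open import Data.Fin using (Fin; zero; suc)
open import Data.Bool using (Bool; true; false)
open import Data.Rational using (ℚ; 0ℚ; 1ℚ; _+_; _*_)
open import Data.Product using (Σ; _×_; _,_; ∃; ∃-syntax)
open import Data.Sum using (_⊎_)
open import Relation.Nullary using (¬_)
open import Relation.Binary.PropositionalEquality using (_≡_)
open import Data.Fin.Permutation using (Permutation′; _⟨$⟩ʳ_)

record Graph (n : ℕ) : Set where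
  field
    adj   : Fin n → Fin n → Bool
    sym   : ∀ u v → adj u v ≡ adj v u
    irrefl : ∀ v → adj v v ≡ false
open Graph public

data Walk {n : ℕ} (G : Graph n) : Fin n → Fin n → Set where
  here : ∀ {v} → Walk G v v
  step : ∀ {u w v} → adj G u w ≡ true → Walk G w v → Walk G u v

Connected : {n : ℕ} → Graph n → Set
Connected {n} G = ∀ (u v : Fin n) → Walk G u v

∑ : (n : ℕ) → (Fin n → ℚ) → ℚ
∑ zero    f = 0ℚ
∑ (suc n) f = f zero + ∑ n (λ i → f (suc i))

A : {n : ℕ} → Graph n → Fin n → Fin n → ℚ
A G u v with adj G u v
... | true  = 1ℚ
... | false = 0ℚ

InKernel : {n : ℕ} → Graph n → (Fin n → ℚ) → Set
InKernel {n} G x = ∀ (u : Fin n) → ∑ n (λ v → A G u v * x v) ≡ 0ℚ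

IsNut : {n : ℕ} → Graph n → Set
IsNut {n} G =
  Connected G ×
  Σ (Fin n → ℚ) λ x →
    InKernel G x ×
    (∀ v → ¬ (x v ≡ 0ℚ)) ×
    (∀ y → InKernel G y → ∃[ c ] (∀ v → y v ≡ c * x v))

IsAut : {n : ℕ} → Graph n → Permutation′ n → Set
IsAut {n} G σ = ∀ (u v : Fin n) → adj G (σ ⟨$⟩ʳ u) (σ ⟨$⟩ʳ v) ≡ adj G u v

SameOrbit : {n : ℕ} → Graph n → Fin n → Fin n → Set
SameOrbit {n} G u v = Σ (Permutation′ n) λ σ → IsAut G σ × (σ ⟨$⟩ʳ u ≡ v)

TwoOrbits : {n : ℕ} → Graph n → Set
TwoOrbits {n} G = Σ (Fin n) λ u → Σ (Fin n) λ v →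
  ¬ SameOrbit G u v × (∀ w → SameOrbit G u w ⊎ SameOrbit G v w)

-- Write a composite n ≥ 9 as 3q (q ≥ 3), as 2k (k ≥ 5, 3 ∤ k) or as d(2b + 3) with d ≥ 3 odd.
-- The graphs live on ℤ_k × (X ⊎ Y), with the same number of X- and of Y-vertices in every row:
--   * 3q and d(2b + 3) ("clique ring"): every row is a clique and every Y-column is a k-cycle;
--   * 2k ("skew antiprism"): x_r ~ x_{r±1}, y_r ~ y_{r±2}, x_r ~ y_r, y_{r+1}.
-- Every vertex has as many X- as Y-neighbours, so +1 on X and -1 on Y is a kernel vector. Read
-- along the rows, any kernel vector gives k-periodic rational sequences satisfying linear
-- recurrences; since a harmonic periodic sequence is constant, an antiperiodic sequence of odd
-- period vanishes, and periods 3 and k with 3 ∤ k give period 1, the kernel is one-dimensional.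
-- Rotations of ℤ_k and permutations inside a layer act transitively on each layer, and an
-- automorphism-invariant local property separates the layers: every edge at an X-vertex of the
-- skew antiprism lies in a triangle but y_0 y_2 does not (this needs k ≠ 6), and the
-- neighbourhood of an X-vertex of the clique ring is a clique but that of a Y-vertex is not.
module Submission where

open import Level using (0ℓ)
open import Function.Base using (_∘_; id)
open import Function.Bundles using (_⇔_; mk⇔)
open import Data.Empty using (⊥; ⊥-elim)
open import Data.Bool using (true; false; if_then_else_)
open import Data.Product as Product using (Σ; _×_; _,_; proj₁; proj₂; ∃-syntax)
open import Data.Sum as Sum using (_⊎_; inj₁; inj₂)
open import Relation.Binary using (tri<; tri≈; tri>)
open import Relation.Binary.PropositionalEquality
open import Relation.Nullary using (¬_; Dec; yes; no; does)
open import Relation.Nullary.Decidable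
  using (True; False; toWitness; toWitnessFalse; from-yes; dec⇒maybe; dec-true; dec-false; does-⇔; _⊎-dec_; _×-dec_; ¬?)

open import Data.Nat as ℕ using (ℕ; zero; suc; _∸_; _≥_; _≤_; _<_; z≤n; s≤s; NonZero)
import Data.Nat.Properties as ℕP
open import Data.Nat.DivMod as ℕDM using (_mod_)
open import Data.Nat.Divisibility using (_∣_; _∣?_; divides; m%n≡0⇒n∣m; ∣⇒≤; ∣m⇒∣m*n; ∣n⇒∣m*n)
open import Data.Nat.Divisibility.Core using (hasNonTrivialDivisor)
open import Data.Nat.GCD using (module Bézout)
open import Data.Nat.Coprimality as Coprimality using (Coprime; coprime-Bézout; coprime-divisor)
open import Data.Nat.Primality using (Prime; Composite; prime?; prime⇒irreducible; ¬prime⇒composite)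
open import Data.Nat.Tactic.RingSolver using () renaming (solve-∀ to ℕ-solve)
open import Data.Fin as Fin using (Fin; zero; suc; toℕ; combine; remQuot; join; splitAt; _↑ˡ_; _↑ʳ_)
import Data.Fin.Properties as FinP
open import Data.Fin.Permutation as Perm
  using (Permutation′; _⟨$⟩ʳ_; _⟨$⟩ˡ_; permutation; inverseʳ; inverseˡ)
open import Data.Rational as ℚ using (ℚ; 0ℚ; 1ℚ; _+_; _*_; -_; _-_)
import Data.Rational.Properties as ℚP

open import Algebra.Bundles using (Ring; Monoid)
open import Algebra.Definitions.RawMonoid (Monoid.rawMonoid ℚP.+-0-monoid) using () renaming (_×_ to _·_)
open import Algebra.Properties.CommutativeMonoid.Mult ℚP.+-0-commutativeMonoid using (×-distrib-+)
open import Algebra.Properties.Group ℚP.+-0-group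
  using () renaming (inverseˡ-unique to +≡0⇒≡-; x∙y⁻¹≈ε⇒x≈y to -≡0⇒≡; ⁻¹-involutive to neg-involutive)
open import Algebra.Properties.Semiring.Sum (Ring.semiring ℚP.+-*-ring)
  using (sum; sum-cong-≗; ∑-distrib-+; *-distribˡ-sum; sum-replicate; sum-replicate-zero)
open import Tactic.RingSolver using (solve-∀)
import Tactic.RingSolver.Core.AlmostCommutativeRing as ACR

open import Defs hiding (sym)

ℚ-ring : ACR.AlmostCommutativeRing 0ℓ 0ℓ
ℚ-ring = ACR.fromCommutativeRing ℚP.+-*-commutativeRing λ x → dec⇒maybe (0ℚ ℚP.≟ x)

∑≡sum : ∀ n (f : Fin n → ℚ) → ∑ n f ≡ sum f
∑≡sum zero    f = refl
∑≡sum (suc n) f = cong (f zero +_) (∑≡sum n (f ∘ suc))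

∑-cong : ∀ n {f g : Fin n → ℚ} → (∀ i → f i ≡ g i) → ∑ n f ≡ ∑ n g
∑-cong n {f} {g} f≗g = trans (∑≡sum n f) (trans (sum-cong-≗ f≗g) (sym (∑≡sum n g)))

𝟙 : {A : Set} → Dec A → ℚ
𝟙 a? = if does a? then 1ℚ else 0ℚ

𝟙-¬ : ∀ {A : Set} (a? : Dec A) → 𝟙 (¬? a?) ≡ 1ℚ - 𝟙 a?
𝟙-¬ (yes _) = refl
𝟙-¬ (no _)  = refl

module _ {A B : Set} where

  𝟙-⇔ : A ⇔ B → (a? : Dec A) (b? : Dec B) → 𝟙 a? ≡ 𝟙 b?
  𝟙-⇔ A⇔B a? b? = cong (if_then 1ℚ else 0ℚ) (does-⇔ A⇔B a? b?)

  𝟙-⊎ : (A → B → ⊥) → (a? : Dec A) (b? : Dec B) → 𝟙 (a? ⊎-dec b?) ≡ 𝟙 a? + 𝟙 b?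
  𝟙-⊎ disjoint (yes a) (yes b) = ⊥-elim (disjoint a b)
  𝟙-⊎ disjoint (yes _) (no _)  = refl
  𝟙-⊎ disjoint (no _)  (yes _) = refl
  𝟙-⊎ disjoint (no _)  (no _)  = refl

  𝟙-× : (a? : Dec A) (b? : Dec B) → 𝟙 (a? ×-dec b?) ≡ 𝟙 a? * 𝟙 b?
  𝟙-× (yes _) (yes _) = refl
  𝟙-× (yes _) (no _)  = refl
  𝟙-× (no _)  b?      = sym (ℚP.*-zeroˡ (𝟙 b?))

sum-*ˡ : ∀ {n} c (f : Fin n → ℚ) → sum (λ i → c * f i) ≡ c * sum f
sum-*ˡ c f = sym (*-distribˡ-sum c f)

sum-δ : ∀ {n} (j : Fin n) (f : Fin n → ℚ) → sum (λ i → 𝟙 (i Fin.≟ j) * f i) ≡ f j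
sum-δ {suc n} zero f = begin
  1ℚ * f zero + sum (λ i → 0ℚ * f (suc i))
    ≡⟨ cong₂ _+_ (ℚP.*-identityˡ (f zero)) (sum-cong-≗ (ℚP.*-zeroˡ ∘ f ∘ suc)) ⟩
  f zero + sum {n} (λ _ → 0ℚ)   ≡⟨ cong (f zero +_) (sum-replicate-zero n) ⟩
  f zero + 0ℚ                   ≡⟨ ℚP.+-identityʳ (f zero) ⟩
  f zero                        ∎
  where open ≡-Reasoning
sum-δ {suc n} (suc j) f = begin
  0ℚ * f zero + sum (λ i → 𝟙 (i Fin.≟ j) * f (suc i)) ≡⟨ cong₂ _+_ (ℚP.*-zeroˡ (f zero)) (sum-δ j (f ∘ suc)) ⟩
  0ℚ + f (suc j)                                       ≡⟨ ℚP.+-identityˡ (f (suc j)) ⟩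
  f (suc j)                                            ∎
  where open ≡-Reasoning

sum-δ-× : ∀ {E : Set} {n} (j : Fin n) (e? : Dec E) (f : Fin n → ℚ) →
          sum (λ i → 𝟙 ((i Fin.≟ j) ×-dec e?) * f i) ≡ 𝟙 e? * f j
sum-δ-× j e? f = trans (sum-cong-≗ factor) (sum-δ j (λ i → 𝟙 e? * f i))
  where
  factor : ∀ i → 𝟙 ((i Fin.≟ j) ×-dec e?) * f i ≡ 𝟙 (i Fin.≟ j) * (𝟙 e? * f i)
  factor i = trans (cong (_* f i) (𝟙-× (i Fin.≟ j) e?)) (ℚP.*-assoc (𝟙 (i Fin.≟ j)) (𝟙 e?) (f i))

sum-𝟙-≢ : ∀ {n} (j : Fin n) (f : Fin n → ℚ) → sum (λ i → 𝟙 (¬? (i Fin.≟ j)) * f i) ≡ sum f - f j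
sum-𝟙-≢ j f = begin
  sum (λ i → 𝟙 (¬? (i Fin.≟ j)) * f i) ≡⟨ sum-cong-≗ expand ⟩
  sum (λ i → f i + - 1ℚ * δf i)        ≡⟨ ∑-distrib-+ f (λ i → - 1ℚ * δf i) ⟩
  sum f + sum (λ i → - 1ℚ * δf i)      ≡⟨ cong (sum f +_) (sum-*ˡ (- 1ℚ) δf) ⟩
  sum f + - 1ℚ * sum δf                ≡⟨ cong (λ x → sum f + - 1ℚ * x) (sum-δ j f) ⟩
  sum f + - 1ℚ * f j                   ≡⟨ contract (sum f) (f j) ⟩
  sum f - f j                          ∎
  where
  open ≡-Reasoning
  δf : Fin _ → ℚ
  δf i = 𝟙 (i Fin.≟ j) * f i
  expand : ∀ i → 𝟙 (¬? (i Fin.≟ j)) * f i ≡ f i + - 1ℚ * δf i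
  expand i = trans (cong (_* f i) (𝟙-¬ (i Fin.≟ j))) (distribute (𝟙 (i Fin.≟ j)) (f i))
    where
    distribute : ∀ e x → (1ℚ - e) * x ≡ x + - 1ℚ * (e * x)
    distribute = solve-∀ ℚ-ring
  contract : ∀ s x → s + - 1ℚ * x ≡ s - x
  contract = solve-∀ ℚ-ring

module _ {n : ℕ} {A B : Fin n → Set} (a? : ∀ i → Dec (A i)) (b? : ∀ i → Dec (B i)) (f : Fin n → ℚ) where

  sum-𝟙-⊎ : (∀ i → A i → B i → ⊥) →
            sum (λ i → 𝟙 (a? i ⊎-dec b? i) * f i) ≡ sum (λ i → 𝟙 (a? i) * f i) + sum (λ i → 𝟙 (b? i) * f i)
  sum-𝟙-⊎ disjoint = trans (sum-cong-≗ split) (∑-distrib-+ (λ i → 𝟙 (a? i) * f i) (λ i → 𝟙 (b? i) * f i))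
    where
    split : ∀ i → 𝟙 (a? i ⊎-dec b? i) * f i ≡ 𝟙 (a? i) * f i + 𝟙 (b? i) * f i
    split i = trans (cong (_* f i) (𝟙-⊎ (disjoint i) (a? i) (b? i))) (ℚP.*-distribʳ-+ (f i) (𝟙 (a? i)) (𝟙 (b? i)))

sum-𝟙-×ˡ : ∀ {A : Set} {n} {B : Fin n → Set} (a? : Dec A) (b? : ∀ i → Dec (B i)) (f : Fin n → ℚ) →
           sum (λ i → 𝟙 (a? ×-dec b? i) * f i) ≡ 𝟙 a? * sum (λ i → 𝟙 (b? i) * f i)
sum-𝟙-×ˡ a? b? f = trans (sum-cong-≗ factor) (sum-*ˡ (𝟙 a?) (λ i → 𝟙 (b? i) * f i))
  where
  factor : ∀ i → 𝟙 (a? ×-dec b? i) * f i ≡ 𝟙 a? * (𝟙 (b? i) * f i)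
  factor i = trans (cong (_* f i) (𝟙-× a? (b? i))) (ℚP.*-assoc (𝟙 a?) (𝟙 (b? i)) (f i))

sum-↑ : ∀ m n (f : Fin (m ℕ.+ n) → ℚ) → sum {m ℕ.+ n} f ≡ sum {m} (f ∘ (_↑ˡ n)) + sum {n} (f ∘ (m ↑ʳ_))
sum-↑ zero    n f = sym (ℚP.+-identityˡ _)
sum-↑ (suc m) n f = trans (cong (f zero +_) (sum-↑ m n (f ∘ suc)))
  (sym (ℚP.+-assoc (f zero) (sum {m} (f ∘ suc ∘ (_↑ˡ n))) (sum {n} (f ∘ (suc m ↑ʳ_)))))

sum-splitAt : ∀ t u (h : Fin t ⊎ Fin u → ℚ) →
              sum {t ℕ.+ u} (h ∘ splitAt t) ≡ sum {t} (h ∘ inj₁) + sum {u} (h ∘ inj₂)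
sum-splitAt zero    u h = sym (ℚP.+-identityˡ _)
sum-splitAt (suc t) u h = trans (cong (h (inj₁ zero) +_) (sum-splitAt t u (h ∘ Sum.map suc id)))
  (sym (ℚP.+-assoc (h (inj₁ zero)) (sum {t} (h ∘ inj₁ ∘ suc)) (sum {u} (h ∘ inj₂))))

sum-combine : ∀ k m (f : Fin (k ℕ.* m) → ℚ) → sum {k ℕ.* m} f ≡ sum {k} (λ r → sum {m} (f ∘ combine r))
sum-combine zero    m f = refl
sum-combine (suc k) m f =
  trans (sum-↑ m (k ℕ.* m) f) (cong (sum (f ∘ (_↑ˡ k ℕ.* m)) +_) (sum-combine k m (f ∘ (m ↑ʳ_))))

·-nonneg : ∀ n {x} → 0ℚ ℚ.≤ x → 0ℚ ℚ.≤ n · x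
·-nonneg zero    0≤x = ℚP.≤-refl
·-nonneg (suc n) 0≤x = ℚP.+-mono-≤ 0≤x (·-nonneg n 0≤x)

·-pos : ∀ n {x} → 0ℚ ℚ.< x → 0ℚ ℚ.< suc n · x
·-pos n 0<x = ℚP.+-mono-<-≤ 0<x (·-nonneg n (ℚP.<⇒≤ 0<x))

·-neg : ∀ n x → n · (- x) ≡ - (n · x)
·-neg zero    x = refl
·-neg (suc n) x = trans (cong (- x +_) (·-neg n x)) (sym (ℚP.neg-distrib-+ x (n · x)))

·-cancel : ∀ n {x} → suc n · x ≡ 0ℚ → x ≡ 0ℚ
·-cancel n {x} n·x≡0 with ℚP.<-cmp x 0ℚ
... | tri≈ _ x≡0 _ = x≡0
... | tri> _ _ x>0 = ⊥-elim (ℚP.<-irrefl (sym n·x≡0) (·-pos n x>0))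
... | tri< x<0 _ _ = ⊥-elim (ℚP.<-irrefl (sym n·-x≡0) (·-pos n (ℚP.neg-antimono-< x<0)))
  where
  n·-x≡0 : suc n · (- x) ≡ 0ℚ
  n·-x≡0 = trans (·-neg (suc n) x) (cong -_ n·x≡0)

self-negating⇒zero : ∀ {x} → x ≡ - x → x ≡ 0ℚ
self-negating⇒zero {x} x≡-x = ·-cancel 1 (begin
  x + (x + 0ℚ)     ≡⟨ cong (λ y → x + (y + 0ℚ)) x≡-x ⟩
  x + (- x + 0ℚ)   ≡⟨ cancel x ⟩
  0ℚ               ∎)
  where
  open ≡-Reasoning
  cancel : ∀ x → x + (- x + 0ℚ) ≡ 0ℚ
  cancel = solve-∀ ℚ-ring

zero-combination₂ : ∀ {a b} → a ≡ 0ℚ → b ≡ 0ℚ → a - b ≡ 0ℚ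
zero-combination₂ refl refl = refl

zero-combination₄ : ∀ {a b c d} → a ≡ 0ℚ → b ≡ 0ℚ → c ≡ 0ℚ → d ≡ 0ℚ → (a + b) - (c + d) ≡ 0ℚ
zero-combination₄ refl refl refl refl = refl

zero-combination₅ : ∀ {a b c d e} → a ≡ 0ℚ → b ≡ 0ℚ → c ≡ 0ℚ → d ≡ 0ℚ → e ≡ 0ℚ →
                    (a + b + c) - (d + e) ≡ 0ℚ
zero-combination₅ refl refl refl refl refl = refl

¬2∣⇒odd : ∀ {n} → ¬ 2 ∣ n → n ≡ 1 ℕ.+ n ℕ./ 2 ℕ.* 2
¬2∣⇒odd {n} 2∤n with n ℕ.% 2 in n%2≡r | ℕDM.m%n<n n 2
... | 0           | _ = ⊥-elim (2∤n (m%n≡0⇒n∣m n 2 n%2≡r))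
... | 1           | _ = trans (ℕDM.m≡m%n+[m/n]*n n 2) (cong (ℕ._+ n ℕ./ 2 ℕ.* 2) n%2≡r)
... | suc (suc _) | s≤s (s≤s ())

¬2∣∧1<⇒3+2b : ∀ {n} → ¬ 2 ∣ n → 1 < n → ∃[ b ] n ≡ 3 ℕ.+ b ℕ.* 2
¬2∣∧1<⇒3+2b {n} 2∤n 1<n with n ℕ./ 2 | ¬2∣⇒odd 2∤n
... | zero  | n≡1    = ⊥-elim (ℕP.<⇒≢ 1<n (sym n≡1))
... | suc b | n≡3+2b = b , n≡3+2b

¬3∣⇒coprime : ∀ {n} → ¬ 3 ∣ n → Coprime 3 n
¬3∣⇒coprime 3∤n (d∣3 , d∣n) with prime⇒irreducible (from-yes (prime? 3)) d∣3
... | inj₁ d≡1  = d≡1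
... | inj₂ refl = ⊥-elim (3∤n d∣n)

-- Periodic sequences

Periodic : ℕ → (ℕ → ℚ) → Set
Periodic p f = ∀ n → f (p ℕ.+ n) ≡ f n

Antiperiodic : ℕ → (ℕ → ℚ) → Set
Antiperiodic p f = ∀ n → f (p ℕ.+ n) ≡ - f n

Harmonic : (ℕ → ℚ) → Set
Harmonic f = ∀ n → f (2 ℕ.+ n) + f n ≡ f (1 ℕ.+ n) + f (1 ℕ.+ n)

module _ {f : ℕ → ℚ} where

  periodic-* : ∀ {p} → Periodic p f → ∀ m → Periodic (m ℕ.* p) f
  periodic-*     per zero    n = refl
  periodic-* {p} per (suc m) n = begin
    f (p ℕ.+ m ℕ.* p ℕ.+ n)     ≡⟨ cong f (ℕP.+-assoc p (m ℕ.* p) n) ⟩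
    f (p ℕ.+ (m ℕ.* p ℕ.+ n))   ≡⟨ per (m ℕ.* p ℕ.+ n) ⟩
    f (m ℕ.* p ℕ.+ n)           ≡⟨ periodic-* per m n ⟩
    f n                         ∎
    where open ≡-Reasoning

  periodic-Bézout : ∀ {d p q} → Bézout.Identity d p q → Periodic p f → Periodic q f → Periodic d f
  periodic-Bézout {d} {p} {q} (Bézout.+- x y d+yq≡xp) per-p per-q n = begin
    f (d ℕ.+ n)                 ≡⟨ periodic-* per-q y (d ℕ.+ n) ⟨
    f (y ℕ.* q ℕ.+ (d ℕ.+ n))   ≡⟨ cong f (shuffle y q d n) ⟩
    f (d ℕ.+ y ℕ.* q ℕ.+ n)     ≡⟨ cong (λ m → f (m ℕ.+ n)) d+yq≡xp ⟩
    f (x ℕ.* p ℕ.+ n)           ≡⟨ periodic-* per-p x n ⟩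
    f n                         ∎
    where
    open ≡-Reasoning
    shuffle : ∀ y q d n → y ℕ.* q ℕ.+ (d ℕ.+ n) ≡ d ℕ.+ y ℕ.* q ℕ.+ n
    shuffle = ℕ-solve
  periodic-Bézout (Bézout.-+ x y d+xp≡yq) per-p per-q = periodic-Bézout (Bézout.+- y x d+xp≡yq) per-q per-p

  periodic-1⇒constant : Periodic 1 f → ∀ n → f n ≡ f 0
  periodic-1⇒constant per zero    = refl
  periodic-1⇒constant per (suc n) = trans (per n) (periodic-1⇒constant per n)

  periodic-tail-constant : ∀ {p a} → 0 < p → Periodic p f → (∀ n → f (1 ℕ.+ n) ≡ a) → ∀ n → f n ≡ a
  periodic-tail-constant {suc p} _ per f≡a n = trans (sym (per n)) (f≡a (p ℕ.+ n))

  harmonic-increments : Harmonic f → ∀ n → f (1 ℕ.+ n) - f n ≡ f 1 - f 0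
  harmonic-increments harm zero    = refl
  harmonic-increments harm (suc n) = begin
    f (2 ℕ.+ n) - f (1 ℕ.+ n)                         ≡⟨ rearrange (f (2 ℕ.+ n)) (f n) (f (1 ℕ.+ n)) ⟩
    (f (2 ℕ.+ n) + f n) - f (1 ℕ.+ n) - f n           ≡⟨ cong (λ x → x - f (1 ℕ.+ n) - f n) (harm n) ⟩
    (f (1 ℕ.+ n) + f (1 ℕ.+ n)) - f (1 ℕ.+ n) - f n   ≡⟨ cancel (f (1 ℕ.+ n)) (f n) ⟩
    f (1 ℕ.+ n) - f n                                 ≡⟨ harmonic-increments harm n ⟩
    f 1 - f 0                                         ∎
    where
    open ≡-Reasoning
    rearrange : ∀ a b c → a - c ≡ (a + b) - c - b
    rearrange = solve-∀ ℚ-ring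
    cancel : ∀ c b → (c + c) - c - b ≡ c - b
    cancel = solve-∀ ℚ-ring

  arithmetic-progression : ∀ {δ : ℚ} → (∀ n → f (1 ℕ.+ n) - f n ≡ δ) → ∀ n → f n ≡ f 0 + n · δ
  arithmetic-progression     increment zero    = sym (ℚP.+-identityʳ (f 0))
  arithmetic-progression {δ} increment (suc n) = begin
    f (suc n)                 ≡⟨ rearrange (f (suc n)) (f n) ⟩
    f n + (f (suc n) - f n)   ≡⟨ cong₂ _+_ (arithmetic-progression increment n) (increment n) ⟩
    f 0 + n · δ + δ           ≡⟨ rearrange′ (f 0) (n · δ) δ ⟩
    f 0 + (δ + n · δ)         ∎
    where
    open ≡-Reasoning
    rearrange : ∀ a b → a ≡ b + (a - b)
    rearrange = solve-∀ ℚ-ring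
    rearrange′ : ∀ a b c → a + b + c ≡ a + (c + b)
    rearrange′ = solve-∀ ℚ-ring

  -- f n = f 0 + n δ with δ = f 1 - f 0, and periodicity forces p δ = 0.
  harmonic-periodic⇒periodic-1 : ∀ {p} → 0 < p → Periodic p f → Harmonic f → Periodic 1 f
  harmonic-periodic⇒periodic-1 {suc p} _ per harm n =
    -≡0⇒≡ (f (1 ℕ.+ n)) (f n) (trans (harmonic-increments harm n) (·-cancel p p·δ≡0))
    where
    open ≡-Reasoning
    δ : ℚ
    δ = f 1 - f 0
    p·δ≡0 : suc p · δ ≡ 0ℚ
    p·δ≡0 = begin
      suc p · δ                 ≡⟨ rearrange (f 0) (suc p · δ) ⟩
      (f 0 + suc p · δ) - f 0   ≡⟨ cong (_- f 0) (arithmetic-progression (harmonic-increments harm) (suc p)) ⟨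
      f (suc p) - f 0           ≡⟨ cong (λ m → f m - f 0) (ℕP.+-identityʳ (suc p)) ⟨
      f (suc p ℕ.+ 0) - f 0     ≡⟨ cong (_- f 0) (per 0) ⟩
      f 0 - f 0                 ≡⟨ ℚP.+-inverseʳ (f 0) ⟩
      0ℚ                        ∎
      where
      rearrange : ∀ a b → b ≡ (a + b) - a
      rearrange = solve-∀ ℚ-ring

  antiperiodic⇒periodic : ∀ {p} → Antiperiodic p f → Periodic (p ℕ.+ p) f
  antiperiodic⇒periodic {p} anti n = begin
    f (p ℕ.+ p ℕ.+ n)     ≡⟨ cong f (ℕP.+-assoc p p n) ⟩
    f (p ℕ.+ (p ℕ.+ n))   ≡⟨ anti (p ℕ.+ n) ⟩
    - f (p ℕ.+ n)         ≡⟨ cong -_ (anti n) ⟩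
    - - f n               ≡⟨ neg-involutive (f n) ⟩
    f n                   ∎
    where open ≡-Reasoning

  -- Shifting by p q = p + j (p + p) is the identity by periodicity and a sign change by antiperiodicity.
  antiperiodic-odd-period⇒zero : ∀ {p q} → Antiperiodic p f → Periodic q f → ¬ 2 ∣ q → ∀ n → f n ≡ 0ℚ
  antiperiodic-odd-period⇒zero {p} {q} anti per 2∤q n = self-negating⇒zero (begin
    f n                                 ≡⟨ periodic-* per p n ⟨
    f (p ℕ.* q ℕ.+ n)                   ≡⟨ cong (λ m → f (p ℕ.* m ℕ.+ n)) (¬2∣⇒odd 2∤q) ⟩
    f (p ℕ.* (1 ℕ.+ j ℕ.* 2) ℕ.+ n)     ≡⟨ cong f (expand p j n) ⟩
    f (p ℕ.+ (j ℕ.* (p ℕ.+ p) ℕ.+ n))   ≡⟨ anti (j ℕ.* (p ℕ.+ p) ℕ.+ n) ⟩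
    - f (j ℕ.* (p ℕ.+ p) ℕ.+ n)         ≡⟨ cong -_ (periodic-* (antiperiodic⇒periodic anti) j n) ⟩
    - f n                               ∎)
    where
    open ≡-Reasoning
    j : ℕ
    j = q ℕ./ 2
    expand : ∀ p j n → p ℕ.* (1 ℕ.+ j ℕ.* 2) ℕ.+ n ≡ p ℕ.+ (j ℕ.* (p ℕ.+ p) ℕ.+ n)
    expand = ℕ-solve

-- The cycle ℤ_k

module Cyclic (k : ℕ) .{{_ : NonZero k}} where

  infixl 6 _⊕_
  _⊕_ : Fin k → ℕ → Fin k
  r ⊕ a = (a ℕ.+ toℕ r) mod k

  toℕ-mod : ∀ n → toℕ (n mod k) ≡ n ℕ.% k
  toℕ-mod n = FinP.toℕ-fromℕ< (ℕDM.m%n<n n k)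

  mod-cong : ∀ {m n} → m ℕ.% k ≡ n ℕ.% k → m mod k ≡ n mod k
  mod-cong {m} {n} eq = FinP.fromℕ<-cong _ _ eq (ℕDM.m%n<n m k) (ℕDM.m%n<n n k)

  mod-injective : ∀ {m n} → m < k → n < k → m mod k ≡ n mod k → m ≡ n
  mod-injective {m} {n} m<k n<k eq = begin
    m               ≡⟨ ℕDM.m<n⇒m%n≡m m<k ⟨
    m ℕ.% k         ≡⟨ toℕ-mod m ⟨
    toℕ (m mod k)   ≡⟨ cong toℕ eq ⟩
    toℕ (n mod k)   ≡⟨ toℕ-mod n ⟩
    n ℕ.% k         ≡⟨ ℕDM.m<n⇒m%n≡m n<k ⟩
    n               ∎
    where open ≡-Reasoning

  mod-toℕ : ∀ r → toℕ r mod k ≡ r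
  mod-toℕ r = FinP.toℕ-injective (trans (toℕ-mod (toℕ r)) (ℕDM.m<n⇒m%n≡m (FinP.toℕ<n r)))

  mod-periodic : ∀ n → (k ℕ.+ n) mod k ≡ n mod k
  mod-periodic n = mod-cong (trans (cong (ℕ._% k) (ℕP.+-comm k n)) (ℕDM.[m+n]%n≡m%n n k))

  mod-⊕ : ∀ n a → n mod k ⊕ a ≡ (a ℕ.+ n) mod k
  mod-⊕ n a = mod-cong (begin
    (a ℕ.+ toℕ (n mod k)) ℕ.% k               ≡⟨ cong (λ m → (a ℕ.+ m) ℕ.% k) (toℕ-mod n) ⟩
    (a ℕ.+ n ℕ.% k) ℕ.% k                     ≡⟨ ℕDM.%-distribˡ-+ a (n ℕ.% k) k ⟩
    (a ℕ.% k ℕ.+ n ℕ.% k ℕ.% k) ℕ.% k         ≡⟨ cong (λ m → (a ℕ.% k ℕ.+ m) ℕ.% k) (ℕDM.m%n%n≡m%n n k) ⟩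
    (a ℕ.% k ℕ.+ n ℕ.% k) ℕ.% k               ≡⟨ ℕDM.%-distribˡ-+ a n k ⟨
    (a ℕ.+ n) ℕ.% k                           ∎)
    where open ≡-Reasoning

  ⊕-⊕ : ∀ r a b → r ⊕ a ⊕ b ≡ r ⊕ (b ℕ.+ a)
  ⊕-⊕ r a b = trans (mod-⊕ (a ℕ.+ toℕ r) b) (cong (_mod k) (sym (ℕP.+-assoc b a (toℕ r))))

  ⊕-comm : ∀ r a b → r ⊕ a ⊕ b ≡ r ⊕ b ⊕ a
  ⊕-comm r a b = trans (⊕-⊕ r a b) (trans (cong (r ⊕_) (ℕP.+-comm b a)) (sym (⊕-⊕ r b a)))

  ⊕-zero : ∀ r → r ⊕ 0 ≡ r
  ⊕-zero = mod-toℕ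

  ⊕-k : ∀ r → r ⊕ k ≡ r
  ⊕-k r = trans (mod-periodic (toℕ r)) (mod-toℕ r)

  ⊕-inverseʳ : ∀ {a} → a ≤ k → ∀ r → r ⊕ a ⊕ (k ∸ a) ≡ r
  ⊕-inverseʳ a≤k r = trans (⊕-⊕ r _ _) (trans (cong (r ⊕_) (ℕP.m∸n+n≡m a≤k)) (⊕-k r))

  ⊕-inverseˡ : ∀ {a} → a ≤ k → ∀ r → r ⊕ (k ∸ a) ⊕ a ≡ r
  ⊕-inverseˡ {a} a≤k r = trans (⊕-comm r (k ∸ a) a) (⊕-inverseʳ a≤k r)

  ⊕-cancelʳ : ∀ {a r s} → a ≤ k → r ⊕ a ≡ s ⊕ a → r ≡ s
  ⊕-cancelʳ {a} {r} {s} a≤k eq =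
    trans (sym (⊕-inverseʳ a≤k r)) (trans (cong (_⊕ (k ∸ a)) eq) (⊕-inverseʳ a≤k s))

  ⊕-rewind : ∀ r a → r ⊕ a ⊕ (k ∸ toℕ r) ≡ a mod k
  ⊕-rewind r a = trans (⊕-⊕ r a (k ∸ toℕ r)) (trans (cong (_mod k) rearrange) (mod-periodic a))
    where
    rearrange : k ∸ toℕ r ℕ.+ a ℕ.+ toℕ r ≡ k ℕ.+ a
    rearrange = begin
      k ∸ toℕ r ℕ.+ a ℕ.+ toℕ r   ≡⟨ ℕP.+-assoc (k ∸ toℕ r) a (toℕ r) ⟩
      k ∸ toℕ r ℕ.+ (a ℕ.+ toℕ r) ≡⟨ cong (k ∸ toℕ r ℕ.+_) (ℕP.+-comm a (toℕ r)) ⟩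
      k ∸ toℕ r ℕ.+ (toℕ r ℕ.+ a) ≡⟨ ℕP.+-assoc (k ∸ toℕ r) (toℕ r) a ⟨
      k ∸ toℕ r ℕ.+ toℕ r ℕ.+ a   ≡⟨ cong (ℕ._+ a) (ℕP.m∸n+n≡m (ℕP.<⇒≤ (FinP.toℕ<n r))) ⟩
      k ℕ.+ a                     ∎
      where open ≡-Reasoning

  ⊕-congruent : ∀ {r a b} → r ⊕ a ≡ r ⊕ b → a mod k ≡ b mod k
  ⊕-congruent {r} {a} {b} eq =
    trans (sym (⊕-rewind r a)) (trans (cong (_⊕ (k ∸ toℕ r)) eq) (⊕-rewind r b))

  ⊕-cancelˡ : ∀ {r a b} → a < k → b < k → r ⊕ a ≡ r ⊕ b → a ≡ b
  ⊕-cancelˡ a<k b<k eq = mod-injective a<k b<k (⊕-congruent eq)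

  ⊕-no-fixpoint : ∀ {r a} → 0 < a → a < k → r ⊕ a ≢ r
  ⊕-no-fixpoint {r} 0<a a<k eq =
    ℕP.<⇒≢ 0<a (sym (⊕-cancelˡ a<k (ℕP.≤-<-trans z≤n a<k) (trans eq (sym (⊕-zero r)))))

  origin : Fin k
  origin = 0 mod k

  origin-⊕ : ∀ r → origin ⊕ toℕ r ≡ r
  origin-⊕ r = trans (mod-⊕ 0 (toℕ r)) (trans (cong (_mod k) (ℕP.+-identityʳ (toℕ r))) (mod-toℕ r))

  mod-surjective : ∀ {d} → d ≤ k → ∀ r → (d ℕ.+ (k ∸ d ℕ.+ toℕ r)) mod k ≡ r
  mod-surjective {d} d≤k r = begin
    (d ℕ.+ (k ∸ d ℕ.+ toℕ r)) mod k   ≡⟨ cong (_mod k) (ℕP.+-assoc d (k ∸ d) (toℕ r)) ⟨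
    (d ℕ.+ (k ∸ d) ℕ.+ toℕ r) mod k   ≡⟨ cong (λ m → (m ℕ.+ toℕ r) mod k) (ℕP.m+[n∸m]≡n d≤k) ⟩
    (k ℕ.+ toℕ r) mod k               ≡⟨ mod-periodic (toℕ r) ⟩
    toℕ r mod k                       ≡⟨ mod-toℕ r ⟩
    r                                 ∎
    where open ≡-Reasoning

  Step : ℕ → Fin k → Fin k → Set
  Step d r s = s ≡ r ⊕ d

  Step? : ∀ d r s → Dec (Step d r s)
  Step? d r s = s Fin.≟ r ⊕ d

  Step-shift : ∀ {d r s} a → Step d r s → Step d (r ⊕ a) (s ⊕ a)
  Step-shift {d} {r} a refl = ⊕-comm r d a

  Step-irrefl : ∀ {d r} → 0 < d → d < k → ¬ Step d r r
  Step-irrefl 0<d d<k r≡r⊕d = ⊕-no-fixpoint 0<d d<k (sym r≡r⊕d)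

  ≡⇒¬Step : ∀ {d r s} → 0 < d → d < k → s ≡ r → ¬ Step d r s
  ≡⇒¬Step {d} {r} 0<d d<k s≡r st = Step-irrefl 0<d d<k (subst (Step d r) s≡r st)

  ≡⇒¬Step′ : ∀ {d r s} → 0 < d → d < k → s ≡ r → ¬ Step d s r
  ≡⇒¬Step′ {d} {r} 0<d d<k s≡r st = Step-irrefl 0<d d<k (subst (λ z → Step d z r) s≡r st)

  Step-asym : ∀ {d r s} → 0 < d ℕ.+ d → d ℕ.+ d < k → Step d r s → ¬ Step d s r
  Step-asym {d} {r} 0<2d 2d<k refl r≡r⊕d⊕d =
    ⊕-no-fixpoint 0<2d 2d<k (trans (sym (⊕-⊕ r d d)) (sym r≡r⊕d⊕d))

  sum-Step-forward : ∀ d n (f : Fin k → ℚ) → sum (λ s → 𝟙 (Step? d (n mod k) s) * f s) ≡ f ((d ℕ.+ n) mod k)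
  sum-Step-forward d n f = trans (sum-δ (n mod k ⊕ d) f) (cong f (mod-⊕ n d))

  sum-Step-backward : ∀ {d} → d ≤ k → ∀ n (f : Fin k → ℚ) →
                      sum (λ s → 𝟙 (Step? d s ((d ℕ.+ n) mod k)) * f s) ≡ f (n mod k)
  sum-Step-backward {d} d≤k n f =
    trans (sum-cong-≗ (λ s → cong (_* f s) (𝟙-⇔ (back s) (Step? d s _) (s Fin.≟ n mod k)))) (sum-δ (n mod k) f)
    where
    back : ∀ s → Step d s ((d ℕ.+ n) mod k) ⇔ s ≡ n mod k
    back s = mk⇔ (λ eq → ⊕-cancelʳ d≤k (trans (sym eq) (sym (mod-⊕ n d))))
                 (λ { refl → sym (mod-⊕ n d) })

⟨$⟩ʳ-injective : ∀ {n} (σ : Permutation′ n) {i j} → σ ⟨$⟩ʳ i ≡ σ ⟨$⟩ʳ j → i ≡ j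
⟨$⟩ʳ-injective σ eq = trans (sym (inverseˡ σ)) (trans (cong (σ ⟨$⟩ˡ_) eq) (inverseˡ σ))

module _ {n : ℕ} (G : Graph n) where

  Edge : Fin n → Fin n → Set
  Edge u v = adj G u v ≡ true

  edge-sym : ∀ {u v} → Edge u v → Edge v u
  edge-sym {u} {v} e = trans (Graph.sym G v u) e

  _++ᵂ_ : ∀ {u v w} → Walk G u v → Walk G v w → Walk G u w
  here       ++ᵂ q = q
  step e p   ++ᵂ q = step e (p ++ᵂ q)

  reverseᵂ : ∀ {u v} → Walk G u v → Walk G v u
  reverseᵂ here       = here
  reverseᵂ (step e p) = reverseᵂ p ++ᵂ step (edge-sym e) here

  hub⇒connected : ∀ {h} → (∀ u → Walk G u h) → Connected G
  hub⇒connected to-hub u v = to-hub u ++ᵂ reverseᵂ (to-hub v)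

  EdgesInTriangles : Fin n → Set
  EdgesInTriangles u = ∀ v → Edge u v → ∃[ w ] Edge u w × Edge v w

  NeighbourhoodIsClique : Fin n → Set
  NeighbourhoodIsClique u = ∀ v w → Edge u v → Edge u w → v ≢ w → Edge v w

  AutInvariant : (Fin n → Set) → Set
  AutInvariant P = ∀ σ → IsAut G σ → ∀ {u} → P u → P (σ ⟨$⟩ʳ u)

  aut-invariant⇒¬SameOrbit : ∀ {P u v} → AutInvariant P → P u → ¬ P v → ¬ SameOrbit G u v
  aut-invariant⇒¬SameOrbit inv Pu ¬Pv (σ , aut , σu≡v) = ¬Pv (subst _ σu≡v (inv σ aut Pu))

  module _ (σ : Permutation′ n) (aut : IsAut G σ) where

    aut-edge : ∀ {u v} → Edge u v → Edge (σ ⟨$⟩ʳ u) (σ ⟨$⟩ʳ v)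
    aut-edge {u} {v} e = trans (aut u v) e

    aut-edge⁻¹ : ∀ {u v} → Edge (σ ⟨$⟩ʳ u) v → Edge u (σ ⟨$⟩ˡ v)
    aut-edge⁻¹ {u} {v} e =
      trans (sym (aut u (σ ⟨$⟩ˡ v))) (trans (cong (adj G (σ ⟨$⟩ʳ u)) (inverseʳ σ)) e)

  edgesInTriangles-invariant : AutInvariant EdgesInTriangles
  edgesInTriangles-invariant σ aut {u} triangles v e
    with w , uw , vw ← triangles (σ ⟨$⟩ˡ v) (aut-edge⁻¹ σ aut e) =
    σ ⟨$⟩ʳ w , aut-edge σ aut uw , subst (λ x → Edge x (σ ⟨$⟩ʳ w)) (inverseʳ σ) (aut-edge σ aut vw)

  neighbourhoodIsClique-invariant : AutInvariant NeighbourhoodIsClique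
  neighbourhoodIsClique-invariant σ aut {u} clique v w uv uw v≢w =
    subst₂ Edge (inverseʳ σ) (inverseʳ σ) (aut-edge σ aut
      (clique _ _ (aut-edge⁻¹ σ aut uv) (aut-edge⁻¹ σ aut uw) (v≢w ∘ ⟨$⟩ʳ-injective (Perm.flip σ))))

A≡𝟙 : ∀ {n} (G : Graph n) u v → A G u v ≡ (if adj G u v then 1ℚ else 0ℚ)
A≡𝟙 G u v with adj G u v
... | true  = refl
... | false = refl

-- Graphs on ℤ_k × (X ⊎ Y)

Vertex : (k t u : ℕ) → Set
Vertex k t u = Fin k × (Fin (suc t) ⊎ Fin (suc u))

pattern X r i = r , inj₁ i
pattern Y r j = r , inj₂ j

module CyclicLayers (k : ℕ) .{{_ : NonZero k}} (t u : ℕ)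
  (Adj : Vertex k t u → Vertex k t u → Set) (Adj? : ∀ a b → Dec (Adj a b))
  (Adj-sym : ∀ {a b} → Adj a b → Adj b a) (Adj-irrefl : ∀ a → ¬ Adj a a) where

  open Cyclic k

  V : Set
  V = Vertex k t u

  m N : ℕ
  m = suc t ℕ.+ suc u
  N = k ℕ.* m

  enc : V → Fin N
  enc (r , p) = combine r (join (suc t) (suc u) p)

  dec : Fin N → V
  dec w = Product.map₂ (splitAt (suc t)) (remQuot m w)

  dec-enc : ∀ v → dec (enc v) ≡ v
  dec-enc (r , p) = trans (cong (Product.map₂ (splitAt (suc t))) (FinP.remQuot-combine r _))
                          (cong (r ,_) (FinP.splitAt-join (suc t) (suc u) p))

  enc-dec : ∀ w → enc (dec w) ≡ w
  enc-dec w = trans (cong (combine (proj₁ (remQuot {k} m w))) (FinP.join-splitAt (suc t) (suc u) _))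
                    (FinP.combine-remQuot {k} m w)

  enc-injective : ∀ {a b} → enc a ≡ enc b → a ≡ b
  enc-injective {a} {b} eq = trans (sym (dec-enc a)) (trans (cong dec eq) (dec-enc b))

  dec-injective : ∀ {w w′} → dec w ≡ dec w′ → w ≡ w′
  dec-injective {w} {w′} eq = trans (sym (enc-dec w)) (trans (cong enc eq) (enc-dec w′))

  graph : Graph N
  graph = record
    { adj    = λ w w′ → does (Adj? (dec w) (dec w′))
    ; sym    = λ w w′ → does-⇔ (mk⇔ Adj-sym Adj-sym) (Adj? (dec w) (dec w′)) (Adj? (dec w′) (dec w))
    ; irrefl = λ w → dec-false (Adj? (dec w) (dec w)) (Adj-irrefl (dec w))
    }

  edge : ∀ {a b} → Adj a b → Edge graph (enc a) (enc b)
  edge {a} {b} a~b = dec-true (Adj? _ _) (subst₂ Adj (sym (dec-enc a)) (sym (dec-enc b)) a~b)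

  edge⁻¹ : ∀ {w w′} → Edge graph w w′ → Adj (dec w) (dec w′)
  edge⁻¹ {w} {w′} e with Adj? (dec w) (dec w′)
  ... | yes a~b = a~b

  edge-from : ∀ {a w} → Edge graph (enc a) w → Adj a (dec w)
  edge-from {a} e = subst (λ v → Adj v _) (dec-enc a) (edge⁻¹ e)

  ∑V : (V → ℚ) → ℚ
  ∑V h = sum {k} (λ r → sum (h ∘ X r) + sum (h ∘ Y r))

  sum-dec : ∀ h → sum {N} (h ∘ dec) ≡ ∑V h
  sum-dec h = trans (sum-combine k m (h ∘ dec)) (sum-cong-≗ λ r →
    trans (sum-cong-≗ (λ c → cong (h ∘ Product.map₂ (splitAt (suc t))) (FinP.remQuot-combine r c)))
          (sum-splitAt (suc t) (suc u) (h ∘ (r ,_))))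

  RowSum : (V → ℚ) → V → ℚ
  RowSum x a = ∑V (λ b → 𝟙 (Adj? a b) * x b)

  row-sum : ∀ (x : V → ℚ) a → ∑ N (λ w → A graph (enc a) w * x (dec w)) ≡ RowSum x a
  row-sum x a = begin
    ∑ N (λ w → A graph (enc a) w * x (dec w))      ≡⟨ ∑≡sum N _ ⟩
    sum (λ w → A graph (enc a) w * x (dec w))      ≡⟨ sum-cong-≗ entry ⟩
    sum (λ w → 𝟙 (Adj? a (dec w)) * x (dec w))     ≡⟨ sum-dec (λ b → 𝟙 (Adj? a b) * x b) ⟩
    RowSum x a                                     ∎
    where
    open ≡-Reasoning
    entry : ∀ w → A graph (enc a) w * x (dec w) ≡ 𝟙 (Adj? a (dec w)) * x (dec w)
    entry w = cong (_* x (dec w))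
      (trans (A≡𝟙 graph (enc a) w) (cong (λ v → 𝟙 (Adj? v (dec w))) (dec-enc a)))

  kernel⇒rows : ∀ {y} → InKernel graph y → ∀ a → RowSum (y ∘ enc) a ≡ 0ℚ
  kernel⇒rows {y} y∈ker a = begin
    RowSum (y ∘ enc) a                                ≡⟨ row-sum (y ∘ enc) a ⟨
    ∑ N (λ w → A graph (enc a) w * y (enc (dec w)))   ≡⟨ ∑-cong N (cong (A graph (enc a) _ *_) ∘ cong y ∘ enc-dec) ⟩
    ∑ N (λ w → A graph (enc a) w * y w)               ≡⟨ y∈ker (enc a) ⟩
    0ℚ                                                ∎
    where open ≡-Reasoning

  rows⇒kernel : ∀ {x} → (∀ a → RowSum x a ≡ 0ℚ) → InKernel graph (x ∘ dec)
  rows⇒kernel {x} rows w = subst (λ w′ → ∑ N (λ w″ → A graph w′ w″ * x (dec w″)) ≡ 0ℚ) (enc-dec w)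
                                 (trans (row-sum x (dec w)) (rows (dec w)))

  Sign : V → ℚ
  Sign (X _ _) = 1ℚ
  Sign (Y _ _) = - 1ℚ

  Sign-nonzero : ∀ v → Sign v ≢ 0ℚ
  Sign-nonzero (X _ _) ()
  Sign-nonzero (Y _ _) ()

  nut-criterion : ∀ hub → (∀ a → Walk graph (enc a) (enc hub)) → (∀ a → RowSum Sign a ≡ 0ℚ) →
                  (∀ x → (∀ a → RowSum x a ≡ 0ℚ) → ∃[ c ] ∀ v → x v ≡ c * Sign v) → IsNut graph
  nut-criterion hub walks Sign-rows rows⇒multiple =
    hub⇒connected graph to-hub , Sign ∘ dec , rows⇒kernel {Sign} Sign-rows , Sign-nonzero ∘ dec , multiple
    where
    to-hub : ∀ w → Walk graph w (enc hub)
    to-hub w = subst (λ w′ → Walk graph w′ (enc hub)) (enc-dec w) (walks (dec w))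
    multiple : ∀ y → InKernel graph y → ∃[ c ] ∀ w → y w ≡ c * Sign (dec w)
    multiple y y∈ker with c , y≡c·Sign ← rows⇒multiple (y ∘ enc) (kernel⇒rows y∈ker) =
      c , λ w → trans (cong y (sym (enc-dec w))) (y≡c·Sign (dec w))

  walk-along-layer : ∀ p → (∀ n → Adj ((1 ℕ.+ n) mod k , p) (n mod k , p)) →
                     ∀ r → Walk graph (enc (r , p)) (enc (origin , p))
  walk-along-layer p down r = subst (λ r′ → Walk graph (enc (r′ , p)) _) (mod-toℕ r) (walk-from (toℕ r))
    where
    walk-from : ∀ n → Walk graph (enc (n mod k , p)) (enc (origin , p))
    walk-from zero    = here
    walk-from (suc n) = step (edge (down n)) (walk-from n)

  edgesInTriangles : ∀ {a} → (∀ b → Adj a b → ∃[ c ] Adj a c × Adj b c) →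
                     EdgesInTriangles graph (enc a)
  edgesInTriangles triangles w e with c , ac , bc ← triangles (dec w) (edge-from e) =
    enc c , edge ac , subst (λ w′ → Edge graph w′ (enc c)) (enc-dec w) (edge bc)

  ¬edgesInTriangles : ∀ {a b} → Adj a b → (∀ c → Adj a c → Adj b c → ⊥) →
                      ¬ EdgesInTriangles graph (enc a)
  ¬edgesInTriangles ab no-common triangles with w , aw , bw ← triangles _ (edge ab) =
    no-common (dec w) (edge-from aw) (edge-from bw)

  neighbourhoodIsClique : ∀ {a} → (∀ b c → Adj a b → Adj a c → b ≢ c → Adj b c) →
                          NeighbourhoodIsClique graph (enc a)
  neighbourhoodIsClique clique w w′ aw aw′ w≢w′ = subst₂ (Edge graph) (enc-dec w) (enc-dec w′)
    (edge (clique (dec w) (dec w′) (edge-from aw) (edge-from aw′) (w≢w′ ∘ dec-injective)))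

  ¬neighbourhoodIsClique : ∀ {a b c} → Adj a b → Adj a c → b ≢ c → ¬ Adj b c →
                           ¬ NeighbourhoodIsClique graph (enc a)
  ¬neighbourhoodIsClique {b = b} {c} ab ac b≢c ¬bc clique =
    ¬bc (subst₂ Adj (dec-enc b) (dec-enc c)
                    (edge⁻¹ (clique _ _ (edge ab) (edge ac) (b≢c ∘ enc-injective))))

  shift : ℕ → Permutation′ (suc t) → Permutation′ (suc u) → V → V
  shift a σ τ (X r i) = X (r ⊕ a) (σ ⟨$⟩ʳ i)
  shift a σ τ (Y r j) = Y (r ⊕ a) (τ ⟨$⟩ʳ j)

  module _ {a} (a≤k : a ≤ k) (σ : Permutation′ (suc t)) (τ : Permutation′ (suc u)) where

    unshift : V → V
    unshift = shift (k ∸ a) (Perm.flip σ) (Perm.flip τ)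

    unshift-shift : ∀ v → unshift (shift a σ τ v) ≡ v
    unshift-shift (X r i) = cong₂ X (⊕-inverseʳ a≤k r) (inverseˡ σ)
    unshift-shift (Y r j) = cong₂ Y (⊕-inverseʳ a≤k r) (inverseˡ τ)

    shift-unshift : ∀ v → shift a σ τ (unshift v) ≡ v
    shift-unshift (X r i) = cong₂ X (⊕-inverseˡ a≤k r) (inverseʳ σ)
    shift-unshift (Y r j) = cong₂ Y (⊕-inverseˡ a≤k r) (inverseʳ τ)

  module Symmetric (Adj-shift : ∀ a σ τ {v w} → Adj v w → Adj (shift a σ τ v) (shift a σ τ w)) where

    same-orbit : ∀ {a} → a ≤ k → ∀ σ τ v → SameOrbit graph (enc v) (enc (shift a σ τ v))
    same-orbit {a} a≤k σ τ v = perm , aut , cong (enc ∘ shift a σ τ) (dec-enc v)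
      where
      g g⁻¹ : V → V
      g = shift a σ τ
      g⁻¹ = unshift a≤k σ τ
      perm : Permutation′ N
      perm = permutation (enc ∘ g ∘ dec) (enc ∘ g⁻¹ ∘ dec)
        (λ w → trans (cong (enc ∘ g) (dec-enc (g⁻¹ (dec w))))
                     (trans (cong enc (shift-unshift a≤k σ τ (dec w))) (enc-dec w)))
        (λ w → trans (cong (enc ∘ g⁻¹) (dec-enc (g (dec w))))
                     (trans (cong enc (unshift-shift a≤k σ τ (dec w))) (enc-dec w)))
      reflect : ∀ {v w} → Adj (g v) (g w) → Adj v w
      reflect {v} {w} gv~gw =
        subst₂ Adj (unshift-shift a≤k σ τ v) (unshift-shift a≤k σ τ w) (Adj-shift _ _ _ gv~gw)
      aut : IsAut graph perm
      aut w w′ = trans (cong₂ (λ v v′ → does (Adj? v v′)) (dec-enc (g (dec w))) (dec-enc (g (dec w′))))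
                       (does-⇔ (mk⇔ reflect (Adj-shift a σ τ)) (Adj? (g (dec w)) (g (dec w′))) (Adj? (dec w) (dec w′)))

    X-orbit : ∀ r i → SameOrbit graph (enc (X origin zero)) (enc (X r i))
    X-orbit r i = subst (λ r′ → SameOrbit graph _ (enc (X r′ i))) (origin-⊕ r)
      (same-orbit (ℕP.<⇒≤ (FinP.toℕ<n r)) (Perm.transpose zero i) Perm.id (X origin zero))

    Y-orbit : ∀ r j → SameOrbit graph (enc (Y origin zero)) (enc (Y r j))
    Y-orbit r j = subst (λ r′ → SameOrbit graph _ (enc (Y r′ j))) (origin-⊕ r)
      (same-orbit (ℕP.<⇒≤ (FinP.toℕ<n r)) Perm.id (Perm.transpose zero j) (Y origin zero))

    twoOrbits-criterion : ¬ SameOrbit graph (enc (X origin zero)) (enc (Y origin zero)) → TwoOrbits graph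
    twoOrbits-criterion separated = enc (X origin zero) , enc (Y origin zero) , separated , λ w →
      Sum.map (subst (SameOrbit graph _) (enc-dec w)) (subst (SameOrbit graph _) (enc-dec w)) (orbit (dec w))
      where
      orbit : ∀ v → SameOrbit graph (enc (X origin zero)) (enc v)
                  ⊎ SameOrbit graph (enc (Y origin zero)) (enc v)
      orbit (X r i) = inj₁ (X-orbit r i)
      orbit (Y r j) = inj₂ (Y-orbit r j)

-- The skew antiprism

-- xs n and ys n are the values of a kernel vector at x_n and y_n; row-x n and row-y n are the
-- kernel equations at x_{n+1} and y_{n+2}.
module SkewAntiprismKernel {k} (0<k : 0 < k) (3∤k : ¬ 3 ∣ k) {xs ys : ℕ → ℚ}
  (xs-periodic : Periodic k xs) (ys-periodic : Periodic k ys)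
  (row-x : ∀ n → (xs (2 ℕ.+ n) + xs n) + (ys (1 ℕ.+ n) + ys (2 ℕ.+ n)) ≡ 0ℚ)
  (row-y : ∀ n → (xs (2 ℕ.+ n) + xs (1 ℕ.+ n)) + (ys (4 ℕ.+ n) + ys n) ≡ 0ℚ) where

  -- The equations at x_{n+1} and x_{n+5} minus those at y_{n+3} and y_{n+4} eliminate ys.
  xs-harmonic-3 : ∀ n → xs (6 ℕ.+ n) + xs n ≡ xs (3 ℕ.+ n) + xs (3 ℕ.+ n)
  xs-harmonic-3 n =
    trans (combination (xs n) (xs (2 ℕ.+ n)) (xs (3 ℕ.+ n)) (xs (4 ℕ.+ n)) (xs (6 ℕ.+ n))
                       (ys (1 ℕ.+ n)) (ys (2 ℕ.+ n)) (ys (5 ℕ.+ n)) (ys (6 ℕ.+ n)))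
          (trans (cong (xs (3 ℕ.+ n) + xs (3 ℕ.+ n) +_)
                       (zero-combination₄ (row-x n) (row-x (4 ℕ.+ n)) (row-y (1 ℕ.+ n)) (row-y (2 ℕ.+ n))))
                 (ℚP.+-identityʳ _))
    where
    combination : ∀ x₀ x₂ x₃ x₄ x₆ y₁ y₂ y₅ y₆ → x₆ + x₀ ≡ (x₃ + x₃) +
      ((((x₂ + x₀) + (y₁ + y₂)) + ((x₆ + x₄) + (y₅ + y₆)))
        - (((x₃ + x₂) + (y₅ + y₁)) + ((x₄ + x₃) + (y₆ + y₂))))
    combination = solve-∀ ℚ-ring

  xs-period-3 : Periodic 3 xs
  xs-period-3 i = harmonic-periodic⇒periodic-1 0<k along-periodic (λ m → xs-harmonic-3 (m ℕ.* 3 ℕ.+ i)) 0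
    where
    regroup : ∀ k m i → (k ℕ.+ m) ℕ.* 3 ℕ.+ i ≡ 3 ℕ.* k ℕ.+ (m ℕ.* 3 ℕ.+ i)
    regroup = ℕ-solve
    along-periodic : Periodic k (λ m → xs (m ℕ.* 3 ℕ.+ i))
    along-periodic m = trans (cong xs (regroup k m i)) (periodic-* xs-periodic 3 (m ℕ.* 3 ℕ.+ i))

  xs-constant : ∀ n → xs n ≡ xs 0
  xs-constant = periodic-1⇒constant
    (periodic-Bézout (coprime-Bézout (¬3∣⇒coprime 3∤k)) xs-period-3 xs-periodic)

  ys-constant : ∀ n → ys n ≡ - xs 0
  ys-constant = periodic-tail-constant 0<k ys-periodic ys-succ
    where
    c : ℚ
    c = xs 0
    row-x′ : ∀ n → (c + c) + (ys (1 ℕ.+ n) + ys (2 ℕ.+ n)) ≡ 0ℚ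
    row-x′ n = trans (cong₂ (λ a b → (a + b) + _) (sym (xs-constant (2 ℕ.+ n))) (sym (xs-constant n))) (row-x n)
    row-y′ : ∀ n → (c + c) + (ys (4 ℕ.+ n) + ys n) ≡ 0ℚ
    row-y′ n = trans (cong₂ (λ a b → (a + b) + _) (sym (xs-constant (2 ℕ.+ n))) (sym (xs-constant (1 ℕ.+ n))))
                     (row-y n)
    combination : ∀ c y₁ y₂ y₃ y₄ y₅ → (y₁ + c) + ((y₁ + c) + 0ℚ) ≡
      (((c + c) + (y₅ + y₁)) + ((c + c) + (y₃ + y₄)) + ((c + c) + (y₁ + y₂)))
        - (((c + c) + (y₄ + y₅)) + ((c + c) + (y₂ + y₃)))
    combination = solve-∀ ℚ-ring
    ys-succ : ∀ n → ys (1 ℕ.+ n) ≡ - c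
    ys-succ n = +≡0⇒≡- _ c (·-cancel 1 (trans
      (combination c (ys (1 ℕ.+ n)) (ys (2 ℕ.+ n)) (ys (3 ℕ.+ n)) (ys (4 ℕ.+ n)) (ys (5 ℕ.+ n)))
      (zero-combination₅ (row-y′ (1 ℕ.+ n)) (row-x′ (2 ℕ.+ n)) (row-x′ n) (row-x′ (3 ℕ.+ n)) (row-x′ (1 ℕ.+ n)))))

module SkewAntiprism (k : ℕ) (5≤k : 5 ≤ k) (3∤k : ¬ 3 ∣ k) where

  0<k : 0 < k
  0<k = ℕP.<-≤-trans (s≤s z≤n) 5≤k

  instance
    k-nonZero : NonZero k
    k-nonZero = ℕ.>-nonZero 0<k

  open Cyclic k

  below-k : ∀ {m} → m ≤ 4 → m < k
  below-k m≤4 = ℕP.<-≤-trans (s≤s m≤4) 5≤k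

  1<k : 1 < k
  1<k = below-k (s≤s z≤n)

  2<k : 2 < k
  2<k = below-k (s≤s (s≤s z≤n))

  Adj : Vertex k 0 0 → Vertex k 0 0 → Set
  Adj (X r _) (X s _) = Step 1 r s ⊎ Step 1 s r
  Adj (X r _) (Y s _) = s ≡ r ⊎ Step 1 r s
  Adj (Y r _) (X s _) = s ≡ r ⊎ Step 1 s r
  Adj (Y r _) (Y s _) = Step 2 r s ⊎ Step 2 s r

  Adj? : ∀ a b → Dec (Adj a b)
  Adj? (X r _) (X s _) = Step? 1 r s ⊎-dec Step? 1 s r
  Adj? (X r _) (Y s _) = (s Fin.≟ r) ⊎-dec Step? 1 r s
  Adj? (Y r _) (X s _) = (s Fin.≟ r) ⊎-dec Step? 1 s r
  Adj? (Y r _) (Y s _) = Step? 2 r s ⊎-dec Step? 2 s r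

  Adj-sym : ∀ {a b} → Adj a b → Adj b a
  Adj-sym {X _ _} {X _ _} = Sum.swap
  Adj-sym {X _ _} {Y _ _} = Sum.map₁ sym
  Adj-sym {Y _ _} {X _ _} = Sum.map₁ sym
  Adj-sym {Y _ _} {Y _ _} = Sum.swap

  Adj-irrefl : ∀ a → ¬ Adj a a
  Adj-irrefl (X r _) = Sum.[ Step-irrefl (s≤s z≤n) 1<k , Step-irrefl (s≤s z≤n) 1<k ]
  Adj-irrefl (Y r _) = Sum.[ Step-irrefl (s≤s z≤n) 2<k , Step-irrefl (s≤s z≤n) 2<k ]

  module Layers = CyclicLayers k 0 0 Adj Adj? Adj-sym Adj-irrefl
  open Layers
  open Layers public using (graph)

  Adj-shift : ∀ a σ τ {v w} → Adj v w → Adj (shift a σ τ v) (shift a σ τ w)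
  Adj-shift a σ τ {X _ _} {X _ _} = Sum.map (Step-shift a) (Step-shift a)
  Adj-shift a σ τ {X _ _} {Y _ _} = Sum.map (cong (_⊕ a)) (Step-shift a)
  Adj-shift a σ τ {Y _ _} {X _ _} = Sum.map (cong (_⊕ a)) (Step-shift a)
  Adj-shift a σ τ {Y _ _} {Y _ _} = Sum.map (Step-shift a) (Step-shift a)

  open Symmetric Adj-shift

  row-sum-layers : ∀ x a → RowSum x a ≡ sum (λ s → 𝟙 (Adj? a (X s zero)) * x (X s zero))
                                        + sum (λ s → 𝟙 (Adj? a (Y s zero)) * x (Y s zero))
  row-sum-layers x a = trans (sum-cong-≗ (λ s → cong₂ _+_ (ℚP.+-identityʳ (X-term s)) (ℚP.+-identityʳ (Y-term s))))
                             (∑-distrib-+ X-term Y-term)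
    where
    X-term Y-term : Fin k → ℚ
    X-term s = 𝟙 (Adj? a (X s zero)) * x (X s zero)
    Y-term s = 𝟙 (Adj? a (Y s zero)) * x (Y s zero)

  module _ (x : V → ℚ) where

    xs ys : ℕ → ℚ
    xs n = x (X (n mod k) zero)
    ys n = x (Y (n mod k) zero)

    row-X : ∀ n → RowSum x (X ((1 ℕ.+ n) mod k) zero) ≡ (xs (2 ℕ.+ n) + xs n) + (ys (1 ℕ.+ n) + ys (2 ℕ.+ n))
    row-X n = trans (row-sum-layers x (X r zero)) (cong₂ _+_
      (trans (sum-𝟙-⊎ (Step? 1 r) (λ s → Step? 1 s r) (x ∘ (λ s → X s zero))
                      (λ s → Step-asym (s≤s z≤n) 2<k))
             (cong₂ _+_ (sum-Step-forward 1 (1 ℕ.+ n) _) (sum-Step-backward (ℕP.<⇒≤ 1<k) n _)))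
      (trans (sum-𝟙-⊎ (Fin._≟ r) (Step? 1 r) (x ∘ (λ s → Y s zero)) (λ s → ≡⇒¬Step (s≤s z≤n) 1<k))
             (cong₂ _+_ (sum-δ r _) (sum-Step-forward 1 (1 ℕ.+ n) _))))
      where
      r : Fin k
      r = (1 ℕ.+ n) mod k

    row-Y : ∀ n → RowSum x (Y ((2 ℕ.+ n) mod k) zero) ≡ (xs (2 ℕ.+ n) + xs (1 ℕ.+ n)) + (ys (4 ℕ.+ n) + ys n)
    row-Y n = trans (row-sum-layers x (Y r zero)) (cong₂ _+_
      (trans (sum-𝟙-⊎ (Fin._≟ r) (λ s → Step? 1 s r) (x ∘ (λ s → X s zero))
                      (λ s → ≡⇒¬Step′ (s≤s z≤n) 1<k))
             (cong₂ _+_ (sum-δ r _) (sum-Step-backward (ℕP.<⇒≤ 1<k) (1 ℕ.+ n) _)))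
      (trans (sum-𝟙-⊎ (Step? 2 r) (λ s → Step? 2 s r) (x ∘ (λ s → Y s zero))
                      (λ s → Step-asym (s≤s z≤n) (below-k ℕP.≤-refl)))
             (cong₂ _+_ (sum-Step-forward 2 (2 ℕ.+ n) _) (sum-Step-backward (ℕP.<⇒≤ 2<k) n _))))
      where
      r : Fin k
      r = (2 ℕ.+ n) mod k

  Sign-rows : ∀ a → RowSum Sign a ≡ 0ℚ
  Sign-rows (X r zero) =
    subst (λ r′ → RowSum Sign (X r′ zero) ≡ 0ℚ) (mod-surjective (ℕP.<⇒≤ 1<k) r) (row-X Sign (k ∸ 1 ℕ.+ toℕ r))
  Sign-rows (Y r zero) =
    subst (λ r′ → RowSum Sign (Y r′ zero) ≡ 0ℚ) (mod-surjective (ℕP.<⇒≤ 2<k) r) (row-Y Sign (k ∸ 2 ℕ.+ toℕ r))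

  kernel-multiple : ∀ x → (∀ a → RowSum x a ≡ 0ℚ) → ∃[ c ] ∀ v → x v ≡ c * Sign v
  kernel-multiple x rows = xs x 0 , on-vertex
    where
    open SkewAntiprismKernel 0<k 3∤k {xs x} {ys x} (λ n → cong (λ r → x (X r zero)) (mod-periodic n))
      (λ n → cong (λ r → x (Y r zero)) (mod-periodic n))
      (λ n → trans (sym (row-X x n)) (rows (X ((1 ℕ.+ n) mod k) zero)))
      (λ n → trans (sym (row-Y x n)) (rows (Y ((2 ℕ.+ n) mod k) zero)))
    on-vertex : ∀ v → x v ≡ xs x 0 * Sign v
    on-vertex (X r zero) = trans (cong (λ r′ → x (X r′ zero)) (sym (mod-toℕ r)))
                                 (trans (xs-constant (toℕ r)) (sym (ℚP.*-identityʳ (xs x 0))))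
    on-vertex (Y r zero) = trans (cong (λ r′ → x (Y r′ zero)) (sym (mod-toℕ r)))
                                 (trans (ys-constant (toℕ r)) (neg≡*-1 (xs x 0)))
      where
      neg≡*-1 : ∀ c → - c ≡ c * - 1ℚ
      neg≡*-1 = solve-∀ ℚ-ring

  walks : ∀ a → Walk graph (enc a) (enc (X origin zero))
  walks (X r zero) = walk-along-layer (inj₁ zero) (λ n → inj₂ (sym (mod-⊕ n 1))) r
  walks (Y r zero) = step (edge {Y r zero} {X r zero} (inj₁ refl)) (walks (X r zero))

  X-triangles : ∀ {r} b → Adj (X r zero) b → ∃[ c ] Adj (X r zero) c × Adj b c
  X-triangles (X s _) (inj₁ s≡r⊕1) = Y s zero , inj₂ s≡r⊕1 , inj₁ refl
  X-triangles (X s _) (inj₂ r≡s⊕1) = Y _ zero , inj₁ refl , inj₂ r≡s⊕1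
  X-triangles {r} (Y s _) (inj₁ s≡r) = X (r ⊕ (k ∸ 1)) zero , inj₂ r≡r⁻⊕1 , inj₂ (trans s≡r r≡r⁻⊕1)
    where
    r≡r⁻⊕1 : r ≡ r ⊕ (k ∸ 1) ⊕ 1
    r≡r⁻⊕1 = sym (⊕-inverseˡ (ℕP.<⇒≤ 1<k) r)
  X-triangles (Y s _) (inj₂ s≡r⊕1) = X s zero , inj₁ s≡r⊕1 , inj₁ refl

  ⊕-distinct : ∀ {r} a b {a≤4 : True (a ℕ.≤? 4)} {b≤4 : True (b ℕ.≤? 4)} {a≢b : False (a ℕ.≟ b)} →
               r ⊕ a ≢ r ⊕ b
  ⊕-distinct a b {a≤4} {b≤4} {a≢b} eq =
    toWitnessFalse a≢b (⊕-cancelˡ (below-k (toWitness a≤4)) (below-k (toWitness b≤4)) eq)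

  ⊕-six : ∀ {r} → r ⊕ 0 ≢ r ⊕ 6
  ⊕-six eq = ℕP.<⇒≱ 2<k (∣⇒≤ (coprime-divisor (Coprimality.sym (¬3∣⇒coprime 3∤k)) k∣6))
    where
    6%k≡0 : 6 ℕ.% k ≡ 0
    6%k≡0 = trans (sym (toℕ-mod 6)) (trans (cong toℕ (sym (⊕-congruent eq))) (trans (toℕ-mod 0) (ℕDM.m<n⇒m%n≡m 0<k)))
    k∣6 : k ∣ 3 ℕ.* 2
    k∣6 = m%n≡0⇒n∣m 6 k 6%k≡0

  -- Each case forces r ⊕ a ≡ r ⊕ b with a ≢ b; only the coincidence y_{r+4} = y_{r-2}, i.e. k ∣ 6,
  -- is not already excluded by 5 ≤ k.
  Y-edge-in-no-triangle : ∀ r c → Adj (Y r zero) c → Adj (Y (r ⊕ 2) zero) c → ⊥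
  Y-edge-in-no-triangle r (X s _) (inj₁ refl)  (inj₁ s≡r⊕2)   = ⊕-distinct 0 2 (trans (⊕-zero r) s≡r⊕2)
  Y-edge-in-no-triangle r (X s _) (inj₁ refl)  (inj₂ r⊕2≡r⊕1) = ⊕-distinct 2 1 r⊕2≡r⊕1
  Y-edge-in-no-triangle r (X s _) (inj₂ r≡s⊕1) (inj₁ refl)    =
    ⊕-distinct 0 3 (trans (⊕-zero r) (trans r≡s⊕1 (⊕-⊕ r 2 1)))
  Y-edge-in-no-triangle r (X s _) (inj₂ r≡s⊕1) (inj₂ r⊕2≡s⊕1) =
    ⊕-distinct 0 2 (trans (⊕-zero r) (trans r≡s⊕1 (sym r⊕2≡s⊕1)))
  Y-edge-in-no-triangle r (Y s _) (inj₁ refl)  (inj₁ s≡r⊕2⊕2) = ⊕-distinct 2 4 (trans s≡r⊕2⊕2 (⊕-⊕ r 2 2))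
  Y-edge-in-no-triangle r (Y s _) (inj₁ refl)  (inj₂ r⊕2≡s⊕2) = ⊕-distinct 2 4 (trans r⊕2≡s⊕2 (⊕-⊕ r 2 2))
  Y-edge-in-no-triangle r (Y s _) (inj₂ r≡s⊕2) (inj₁ refl)    =
    ⊕-six (trans (⊕-zero r) (trans r≡s⊕2 (trans (⊕-⊕ (r ⊕ 2) 2 2) (⊕-⊕ r 2 4))))
  Y-edge-in-no-triangle r (Y s _) (inj₂ r≡s⊕2) (inj₂ r⊕2≡s⊕2) =
    ⊕-distinct 0 2 (trans (⊕-zero r) (trans r≡s⊕2 (sym r⊕2≡s⊕2)))

  isNut : IsNut graph
  isNut = nut-criterion (X origin zero) walks Sign-rows kernel-multiple

  twoOrbits : TwoOrbits graph
  twoOrbits = twoOrbits-criterion (aut-invariant⇒¬SameOrbit graph (edgesInTriangles-invariant graph)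
    (edgesInTriangles X-triangles) (¬edgesInTriangles (inj₁ refl) (Y-edge-in-no-triangle origin)))

-- The clique ring

-- xs i n and ys j n are the values of a kernel vector at the i-th X-vertex and the j-th Y-vertex
-- of row n; row-x i n is the kernel equation at (n, X i) and row-y j n the one at (n + 1, Y j).
-- Every X-value equals its row sum S; differences of Y-columns satisfy D (n+2) = D (n+1) - D n,
-- so they are antiperiodic with antiperiod 3 and vanish when k is odd.
module CliqueRingKernel {k} (0<k : 0 < k) {b : ℕ} (k-odd-or-b≡0 : ¬ 2 ∣ k ⊎ b ≡ 0)
  {xs : Fin (2 ℕ.+ b) → ℕ → ℚ} {ys : Fin (1 ℕ.+ b) → ℕ → ℚ}
  (ys-periodic : ∀ j → Periodic k (ys j))
  (row-x : ∀ i n → (sum (λ i′ → xs i′ n) - xs i n) + sum (λ j → ys j n) ≡ 0ℚ)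
  (row-y : ∀ j n → (sum (λ i → xs i (1 ℕ.+ n)) + (sum (λ j′ → ys j′ (1 ℕ.+ n)) - ys j (1 ℕ.+ n)))
                   + (ys j (2 ℕ.+ n) + ys j n) ≡ 0ℚ) where

  Sx Sy S Z : ℕ → ℚ
  Sx n = sum (λ i → xs i n)
  Sy n = sum (λ j → ys j n)
  S n = Sx n + Sy n
  Z = ys zero

  xs≡S : ∀ i n → xs i n ≡ S n
  xs≡S i n = trans (isolate (Sx n) (Sy n) (xs i n)) (trans (cong (λ e → S n - e) (row-x i n)) (ℚP.+-identityʳ (S n)))
    where
    isolate : ∀ sx sy x → x ≡ (sx + sy) - ((sx - x) + sy)
    isolate = solve-∀ ℚ-ring

  column-difference-antiperiodic : ∀ j → Antiperiodic 3 (λ n → ys j n - Z n)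
  column-difference-antiperiodic j n = begin
    D (3 ℕ.+ n)                         ≡⟨ recurrence (1 ℕ.+ n) ⟩
    D (2 ℕ.+ n) - D (1 ℕ.+ n)           ≡⟨ cong (_- D (1 ℕ.+ n)) (recurrence n) ⟩
    (D (1 ℕ.+ n) - D n) - D (1 ℕ.+ n)   ≡⟨ cancel (D (1 ℕ.+ n)) (D n) ⟩
    - D n                               ∎
    where
    open ≡-Reasoning
    D : ℕ → ℚ
    D n = ys j n - Z n
    combination : ∀ sx sy a₀ a₁ a₂ b₀ b₁ b₂ → a₂ - b₂ ≡
      ((a₁ - b₁) - (a₀ - b₀)) + (((sx + (sy - a₁)) + (a₂ + a₀)) - ((sx + (sy - b₁)) + (b₂ + b₀)))
    combination = solve-∀ ℚ-ring
    recurrence : ∀ n → D (2 ℕ.+ n) ≡ D (1 ℕ.+ n) - D n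
    recurrence n = trans
      (combination (Sx (1 ℕ.+ n)) (Sy (1 ℕ.+ n)) (ys j n) (ys j (1 ℕ.+ n)) (ys j (2 ℕ.+ n))
                   (Z n) (Z (1 ℕ.+ n)) (Z (2 ℕ.+ n)))
      (trans (cong (D (1 ℕ.+ n) - D n +_) (zero-combination₂ (row-y j n) (row-y zero n))) (ℚP.+-identityʳ _))
    cancel : ∀ a b → (a - b) - a ≡ - b
    cancel = solve-∀ ℚ-ring

  columns-equal : ∀ j n → ys j n ≡ Z n
  columns-equal j n = Sum.[ odd-columns , (λ b≡0 → cong (λ j′ → ys j′ n) (single-column b≡0 j)) ]′ k-odd-or-b≡0
    where
    odd-columns : ¬ 2 ∣ k → ys j n ≡ Z n
    odd-columns 2∤k = -≡0⇒≡ (ys j n) (Z n) (antiperiodic-odd-period⇒zero (column-difference-antiperiodic j)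
                        (λ m → cong₂ _-_ (ys-periodic j m) (ys-periodic zero m)) 2∤k n)
    single-column : ∀ {b} → b ≡ 0 → (j : Fin (suc b)) → j ≡ zero
    single-column refl zero = refl

  -- S = (b + 2) S + (b + 1) Z, i.e. (b + 1) (S + Z) = 0.
  S+Z≡0 : ∀ n → S n + Z n ≡ 0ℚ
  S+Z≡0 n = ·-cancel b (begin
    suc b · (S n + Z n)                         ≡⟨ ×-distrib-+ (S n) (Z n) (suc b) ⟩
    suc b · S n + suc b · Z n                   ≡⟨ cancel (S n) (suc b · S n) (suc b · Z n) ⟩
    (S n + (suc b · S n + suc b · Z n)) - S n   ≡⟨ cong (_- S n) S≡ ⟨
    S n - S n                                   ≡⟨ ℚP.+-inverseʳ (S n) ⟩
    0ℚ                                          ∎)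
    where
    open ≡-Reasoning
    S≡ : S n ≡ S n + (suc b · S n + suc b · Z n)
    S≡ = trans (cong₂ _+_ (trans (sum-cong-≗ (λ i → xs≡S i n)) (sum-replicate (2 ℕ.+ b) {S n}))
                          (trans (sum-cong-≗ (λ j → columns-equal j n)) (sum-replicate (suc b) {Z n})))
               (ℚP.+-assoc (S n) (suc b · S n) (suc b · Z n))
    cancel : ∀ s a c → a + c ≡ (s + (a + c)) - s
    cancel = solve-∀ ℚ-ring

  Z-harmonic : Harmonic Z
  Z-harmonic n =
    trans (combination (Sx (1 ℕ.+ n)) (Sy (1 ℕ.+ n)) (Z n) (Z (1 ℕ.+ n)) (Z (2 ℕ.+ n)))
          (trans (cong (Z (1 ℕ.+ n) + Z (1 ℕ.+ n) +_) (zero-combination₂ (row-y zero n) (S+Z≡0 (1 ℕ.+ n))))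
                 (ℚP.+-identityʳ _))
    where
    combination : ∀ sx sy z₀ z₁ z₂ →
                  z₂ + z₀ ≡ (z₁ + z₁) + (((sx + (sy - z₁)) + (z₂ + z₀)) - ((sx + sy) + z₁))
    combination = solve-∀ ℚ-ring

  Z-constant : ∀ n → Z n ≡ Z 0
  Z-constant = periodic-1⇒constant (harmonic-periodic⇒periodic-1 0<k (ys-periodic zero) Z-harmonic)

  ys-constant : ∀ j n → ys j n ≡ Z 0
  ys-constant j n = trans (columns-equal j n) (Z-constant n)

  xs-constant : ∀ i n → xs i n ≡ - Z 0
  xs-constant i n = trans (xs≡S i n) (trans (+≡0⇒≡- (S n) (Z n) (S+Z≡0 n)) (cong -_ (Z-constant n)))

module CliqueRing (k : ℕ) (3≤k : 3 ≤ k) (b : ℕ) (k-odd-or-b≡0 : ¬ 2 ∣ k ⊎ b ≡ 0) where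

  0<k : 0 < k
  0<k = ℕP.<-≤-trans (s≤s z≤n) 3≤k

  instance
    k-nonZero : NonZero k
    k-nonZero = ℕ.>-nonZero 0<k

  open Cyclic k

  1<k : 1 < k
  1<k = ℕP.<-≤-trans (s≤s (s≤s z≤n)) 3≤k

  Adj : Vertex k (suc b) b → Vertex k (suc b) b → Set
  Adj (X r i) (X s i′) = s ≡ r × i′ ≢ i
  Adj (X r _) (Y s _)  = s ≡ r
  Adj (Y r _) (X s _)  = s ≡ r
  Adj (Y r j) (Y s j′) = (s ≡ r × j′ ≢ j) ⊎ (j′ ≡ j × (Step 1 r s ⊎ Step 1 s r))

  Adj? : ∀ a b → Dec (Adj a b)
  Adj? (X r i) (X s i′) = (s Fin.≟ r) ×-dec ¬? (i′ Fin.≟ i)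
  Adj? (X r _) (Y s _)  = s Fin.≟ r
  Adj? (Y r _) (X s _)  = s Fin.≟ r
  Adj? (Y r j) (Y s j′) =
    ((s Fin.≟ r) ×-dec ¬? (j′ Fin.≟ j)) ⊎-dec ((j′ Fin.≟ j) ×-dec (Step? 1 r s ⊎-dec Step? 1 s r))

  Adj-sym : ∀ {a b} → Adj a b → Adj b a
  Adj-sym {X _ _} {X _ _} = Product.map sym ≢-sym
  Adj-sym {X _ _} {Y _ _} = sym
  Adj-sym {Y _ _} {X _ _} = sym
  Adj-sym {Y _ _} {Y _ _} = Sum.map (Product.map sym ≢-sym) (Product.map sym Sum.swap)

  Adj-irrefl : ∀ a → ¬ Adj a a
  Adj-irrefl (X r i) (_ , i≢i)            = i≢i refl
  Adj-irrefl (Y r j) (inj₁ (_ , j≢j))     = j≢j refl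
  Adj-irrefl (Y r j) (inj₂ (_ , r~r)) = Sum.[ Step-irrefl (s≤s z≤n) 1<k , Step-irrefl (s≤s z≤n) 1<k ] r~r

  module Layers = CyclicLayers k (suc b) b Adj Adj? Adj-sym Adj-irrefl
  open Layers
  open Layers public using (graph)

  Adj-shift : ∀ a σ τ {v w} → Adj v w → Adj (shift a σ τ v) (shift a σ τ w)
  Adj-shift a σ τ {X _ _} {X _ _} = Product.map (cong (_⊕ a)) (_∘ ⟨$⟩ʳ-injective σ)
  Adj-shift a σ τ {X _ _} {Y _ _} = cong (_⊕ a)
  Adj-shift a σ τ {Y _ _} {X _ _} = cong (_⊕ a)
  Adj-shift a σ τ {Y _ _} {Y _ _} = Sum.map (Product.map (cong (_⊕ a)) (_∘ ⟨$⟩ʳ-injective τ))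
                                            (Product.map (cong (τ ⟨$⟩ʳ_)) (Sum.map (Step-shift a) (Step-shift a)))

  open Symmetric Adj-shift

  module _ (x : V → ℚ) where

    xs : Fin (2 ℕ.+ b) → ℕ → ℚ
    xs i n = x (X (n mod k) i)

    ys : Fin (1 ℕ.+ b) → ℕ → ℚ
    ys j n = x (Y (n mod k) j)

    row-X : ∀ i n → RowSum x (X (n mod k) i) ≡ (sum (λ i′ → xs i′ n) - xs i n) + sum (λ j → ys j n)
    row-X i n = begin
      RowSum x (X r i)
        ≡⟨ sum-cong-≗ (λ s → cong₂ _+_ (sum-𝟙-×ˡ (s Fin.≟ r) (λ i′ → ¬? (i′ Fin.≟ i)) (x ∘ X s))
                                       (sum-*ˡ (𝟙 (s Fin.≟ r)) (x ∘ Y s))) ⟩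
      sum (λ s → 𝟙 (s Fin.≟ r) * X-part s + 𝟙 (s Fin.≟ r) * sum (x ∘ Y s))
        ≡⟨ sum-cong-≗ (λ s → sym (ℚP.*-distribˡ-+ (𝟙 (s Fin.≟ r)) (X-part s) (sum (x ∘ Y s)))) ⟩
      sum (λ s → 𝟙 (s Fin.≟ r) * (X-part s + sum (x ∘ Y s)))
        ≡⟨ sum-δ r (λ s → X-part s + sum (x ∘ Y s)) ⟩
      X-part r + sum (λ j → ys j n)
        ≡⟨ cong (_+ sum (λ j → ys j n)) (sum-𝟙-≢ i (λ i′ → xs i′ n)) ⟩
      (sum (λ i′ → xs i′ n) - xs i n) + sum (λ j → ys j n)
        ∎
      where
      open ≡-Reasoning
      r : Fin k
      r = n mod k
      X-part : Fin k → ℚ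
      X-part s = sum (λ i′ → 𝟙 (¬? (i′ Fin.≟ i)) * x (X s i′))

    module _ (r : Fin k) (j : Fin (suc b)) where

      Cycle? : ∀ s → Dec (Step 1 r s ⊎ Step 1 s r)
      Cycle? s = Step? 1 r s ⊎-dec Step? 1 s r

      other-Y : Fin k → ℚ
      other-Y s = sum (λ j′ → 𝟙 (¬? (j′ Fin.≟ j)) * x (Y s j′))

      Y-row-entry : ∀ s →
        sum (λ i → 𝟙 (s Fin.≟ r) * x (X s i)) + sum (λ j′ → 𝟙 (Adj? (Y r j) (Y s j′)) * x (Y s j′)) ≡
        𝟙 (s Fin.≟ r) * (sum (x ∘ X s) + other-Y s) + 𝟙 (Cycle? s) * x (Y s j)
      Y-row-entry s = trans (cong₂ _+_ (sum-*ˡ (𝟙 (s Fin.≟ r)) (x ∘ X s)) Y-part)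
                            (regroup (𝟙 (s Fin.≟ r)) (sum (x ∘ X s)) (other-Y s) (𝟙 (Cycle? s) * x (Y s j)))
        where
        Y-part : sum (λ j′ → 𝟙 (Adj? (Y r j) (Y s j′)) * x (Y s j′)) ≡
                 𝟙 (s Fin.≟ r) * other-Y s + 𝟙 (Cycle? s) * x (Y s j)
        Y-part = trans
          (sum-𝟙-⊎ (λ j′ → (s Fin.≟ r) ×-dec ¬? (j′ Fin.≟ j)) (λ j′ → (j′ Fin.≟ j) ×-dec Cycle? s) (x ∘ Y s)
                   (λ j′ (_ , j′≢j) (j′≡j , _) → j′≢j j′≡j))
          (cong₂ _+_ (sum-𝟙-×ˡ (s Fin.≟ r) (λ j′ → ¬? (j′ Fin.≟ j)) (x ∘ Y s)) (sum-δ-× j (Cycle? s) (x ∘ Y s)))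
        regroup : ∀ a p q e → a * p + (a * q + e) ≡ a * (p + q) + e
        regroup = solve-∀ ℚ-ring

    row-Y : ∀ j n → RowSum x (Y ((1 ℕ.+ n) mod k) j) ≡
            (sum (λ i → xs i (1 ℕ.+ n)) + (sum (λ j′ → ys j′ (1 ℕ.+ n)) - ys j (1 ℕ.+ n)))
            + (ys j (2 ℕ.+ n) + ys j n)
    row-Y j n = begin
      RowSum x (Y r j)
        ≡⟨ sum-cong-≗ (Y-row-entry r j) ⟩
      sum (λ s → 𝟙 (s Fin.≟ r) * local s + 𝟙 (Cycle? r j s) * x (Y s j))
        ≡⟨ ∑-distrib-+ (λ s → 𝟙 (s Fin.≟ r) * local s) (λ s → 𝟙 (Cycle? r j s) * x (Y s j)) ⟩
      sum (λ s → 𝟙 (s Fin.≟ r) * local s) + sum (λ s → 𝟙 (Cycle? r j s) * x (Y s j))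
        ≡⟨ cong₂ _+_ (trans (sum-δ r local) (cong (sum (x ∘ X r) +_) (sum-𝟙-≢ j (x ∘ Y r)))) cycle-neighbours ⟩
      (sum (λ i → xs i (1 ℕ.+ n)) + (sum (λ j′ → ys j′ (1 ℕ.+ n)) - ys j (1 ℕ.+ n))) + (ys j (2 ℕ.+ n) + ys j n)
        ∎
      where
      open ≡-Reasoning
      r : Fin k
      r = (1 ℕ.+ n) mod k
      local : Fin k → ℚ
      local s = sum (x ∘ X s) + other-Y r j s
      cycle-neighbours : sum (λ s → 𝟙 (Cycle? r j s) * x (Y s j)) ≡ ys j (2 ℕ.+ n) + ys j n
      cycle-neighbours = trans
        (sum-𝟙-⊎ (Step? 1 r) (λ s → Step? 1 s r) (λ s → x (Y s j))
                 (λ s → Step-asym (s≤s z≤n) (ℕP.<-≤-trans ℕP.≤-refl 3≤k)))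
        (cong₂ _+_ (sum-Step-forward 1 (1 ℕ.+ n) _) (sum-Step-backward (ℕP.<⇒≤ 1<k) n _))

  layer-sums : sum {2 ℕ.+ b} (λ _ → 1ℚ) ≡ 1ℚ + suc b · 1ℚ
             × sum {1 ℕ.+ b} (λ _ → - 1ℚ) ≡ - (suc b · 1ℚ)
  layer-sums = sum-replicate (2 ℕ.+ b) {1ℚ} , trans (sum-replicate (1 ℕ.+ b) { - 1ℚ}) (·-neg (suc b) 1ℚ)

  Sign-rows : ∀ a → RowSum Sign a ≡ 0ℚ
  Sign-rows (X r i) = subst (λ r′ → RowSum Sign (X r′ i) ≡ 0ℚ) (mod-toℕ r) (begin
    RowSum Sign (X (toℕ r mod k) i)
      ≡⟨ row-X Sign i (toℕ r) ⟩
    (sum {2 ℕ.+ b} (λ _ → 1ℚ) - 1ℚ) + sum {1 ℕ.+ b} (λ _ → - 1ℚ)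
      ≡⟨ cong₂ (λ p q → (p - 1ℚ) + q) (proj₁ layer-sums) (proj₂ layer-sums) ⟩
    (1ℚ + suc b · 1ℚ - 1ℚ) + - (suc b · 1ℚ)
      ≡⟨ balance (suc b · 1ℚ) ⟩
    0ℚ
      ∎)
    where
    open ≡-Reasoning
    balance : ∀ m → (1ℚ + m - 1ℚ) + - m ≡ 0ℚ
    balance = solve-∀ ℚ-ring
  Sign-rows (Y r j) = subst (λ r′ → RowSum Sign (Y r′ j) ≡ 0ℚ) (mod-surjective (ℕP.<⇒≤ 1<k) r) (begin
    RowSum Sign (Y ((1 ℕ.+ n) mod k) j)
      ≡⟨ row-Y Sign j n ⟩
    (sum {2 ℕ.+ b} (λ _ → 1ℚ) + (sum {1 ℕ.+ b} (λ _ → - 1ℚ) - - 1ℚ)) + (- 1ℚ + - 1ℚ)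
      ≡⟨ cong₂ (λ p q → (p + (q - - 1ℚ)) + (- 1ℚ + - 1ℚ)) (proj₁ layer-sums) (proj₂ layer-sums) ⟩
    (1ℚ + suc b · 1ℚ + (- (suc b · 1ℚ) - - 1ℚ)) + (- 1ℚ + - 1ℚ)
      ≡⟨ balance (suc b · 1ℚ) ⟩
    0ℚ
      ∎)
    where
    open ≡-Reasoning
    n : ℕ
    n = k ∸ 1 ℕ.+ toℕ r
    balance : ∀ m → (1ℚ + m + (- m - - 1ℚ)) + (- 1ℚ + - 1ℚ) ≡ 0ℚ
    balance = solve-∀ ℚ-ring

  kernel-multiple : ∀ x → (∀ a → RowSum x a ≡ 0ℚ) → ∃[ c ] ∀ v → x v ≡ c * Sign v
  kernel-multiple x rows = - Z 0 , on-vertex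
    where
    open CliqueRingKernel 0<k k-odd-or-b≡0 {xs x} {ys x} (λ j n → cong (λ r → x (Y r j)) (mod-periodic n))
      (λ i n → trans (sym (row-X x i n)) (rows (X (n mod k) i)))
      (λ j n → trans (sym (row-Y x j n)) (rows (Y ((1 ℕ.+ n) mod k) j)))
    on-vertex : ∀ v → x v ≡ - Z 0 * Sign v
    on-vertex (X r i) = trans (cong (λ r′ → x (X r′ i)) (sym (mod-toℕ r)))
                              (trans (xs-constant i (toℕ r)) (sym (ℚP.*-identityʳ (- Z 0))))
    on-vertex (Y r j) = trans (cong (λ r′ → x (Y r′ j)) (sym (mod-toℕ r)))
                              (trans (ys-constant j (toℕ r)) (double-negation (Z 0)))
      where
      double-negation : ∀ z → z ≡ - z * - 1ℚ
      double-negation = solve-∀ ℚ-ring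

  walk-Y₀ : ∀ r → Walk graph (enc (Y r zero)) (enc (Y origin zero))
  walk-Y₀ = walk-along-layer (inj₂ zero) (λ n → inj₂ (refl , inj₂ (sym (mod-⊕ n 1))))

  walks : ∀ a → Walk graph (enc a) (enc (Y origin zero))
  walks (X r i) = step (edge {X r i} {Y r zero} refl) (walk-Y₀ r)
  walks (Y r j) = step (edge {Y r j} {X r zero} refl) (walks (X r zero))

  X-clique : ∀ {r i} b c → Adj (X r i) b → Adj (X r i) c → b ≢ c → Adj b c
  X-clique (X s i₁) (X s′ i₂) (s≡r , _) (s′≡r , _) b≢c =
    trans s′≡r (sym s≡r) , λ i₂≡i₁ → b≢c (cong₂ X (trans s≡r (sym s′≡r)) (sym i₂≡i₁))
  X-clique (X s _)  (Y s′ _)  (s≡r , _) s′≡r       _   = trans s′≡r (sym s≡r)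
  X-clique (Y s _)  (X s′ _)  s≡r       (s′≡r , _) _   = trans s′≡r (sym s≡r)
  X-clique (Y s j₁) (Y s′ j₂) s≡r       s′≡r       b≢c =
    inj₁ (trans s′≡r (sym s≡r) , λ j₂≡j₁ → b≢c (cong₂ Y (trans s≡r (sym s′≡r)) (sym j₂≡j₁)))

  Y-not-clique : ¬ NeighbourhoodIsClique graph (enc (Y origin zero))
  Y-not-clique = ¬neighbourhoodIsClique {Y origin zero} {X origin zero} {Y (origin ⊕ 1) zero}
    refl (inj₂ (refl , inj₁ refl)) (λ ()) (⊕-no-fixpoint (s≤s z≤n) 1<k)

  isNut : IsNut graph
  isNut = nut-criterion (Y origin zero) walks Sign-rows kernel-multiple

  twoOrbits : TwoOrbits graph
  twoOrbits = twoOrbits-criterion (aut-invariant⇒¬SameOrbit graph (neighbourhoodIsClique-invariant graph)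
    (neighbourhoodIsClique X-clique) Y-not-clique)

NutWithTwoOrbits : ℕ → Set
NutWithTwoOrbits n = Σ (Graph n) λ G → IsNut G × TwoOrbits G

skew-antiprism : ∀ k → 5 ≤ k → ¬ 3 ∣ k → NutWithTwoOrbits (k ℕ.* 2)
skew-antiprism k 5≤k 3∤k = graph , isNut , twoOrbits
  where open SkewAntiprism k 5≤k 3∤k

clique-ring : ∀ k → 3 ≤ k → ∀ b → ¬ 2 ∣ k ⊎ b ≡ 0 → NutWithTwoOrbits (k ℕ.* (2 ℕ.+ b ℕ.+ (1 ℕ.+ b)))
clique-ring k 3≤k b k-odd-or-b≡0 = graph , isNut , twoOrbits
  where open CliqueRing k 3≤k b k-odd-or-b≡0

odd-composite-factorisation : ∀ {n} → 9 ≤ n → ¬ Prime n → ¬ 2 ∣ n →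
                              ∃[ d ] ∃[ b ] 3 ≤ d × ¬ 2 ∣ d × n ≡ d ℕ.* (2 ℕ.+ b ℕ.+ (1 ℕ.+ b))
odd-composite-factorisation {n} 9≤n ¬prime 2∤n =
  factorise (¬prime⇒composite {{ℕ.n>1⇒nonTrivial (ℕP.<-≤-trans (s≤s (s≤s z≤n)) 9≤n)}} ¬prime)
  where
  factorise : Composite n → ∃[ d ] ∃[ b ] 3 ≤ d × ¬ 2 ∣ d × n ≡ d ℕ.* (2 ℕ.+ b ℕ.+ (1 ℕ.+ b))
  factorise (hasNonTrivialDivisor {d} d<n (divides e n≡e*d)) = d , b , 3≤d , 2∤d , (begin
    n                               ≡⟨ n≡e*d ⟩
    e ℕ.* d                         ≡⟨ cong (ℕ._* d) e≡3+2b ⟩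
    (3 ℕ.+ b ℕ.* 2) ℕ.* d           ≡⟨ regroup b d ⟩
    d ℕ.* (2 ℕ.+ b ℕ.+ (1 ℕ.+ b))   ∎)
    where
    open ≡-Reasoning
    2∤d : ¬ 2 ∣ d
    2∤d 2∣d = 2∤n (subst (2 ∣_) (sym n≡e*d) (∣n⇒∣m*n e 2∣d))
    2∤e : ¬ 2 ∣ e
    2∤e 2∣e = 2∤n (subst (2 ∣_) (sym n≡e*d) (∣m⇒∣m*n d 2∣e))
    1<e : 1 < e
    1<e = ℕP.*-cancelʳ-< d 1 e (subst (_< e ℕ.* d) (sym (ℕP.*-identityˡ d)) (subst (d <_) n≡e*d d<n))
    3≤d : 3 ≤ d
    3≤d with d′ , d≡3+2d′ ← ¬2∣∧1<⇒3+2b 2∤d (ℕ.nonTrivial⇒n>1 d) =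
      subst (3 ≤_) (sym d≡3+2d′) (ℕP.m≤m+n 3 (d′ ℕ.* 2))
    b : ℕ
    b = proj₁ (¬2∣∧1<⇒3+2b 2∤e 1<e)
    e≡3+2b : e ≡ 3 ℕ.+ b ℕ.* 2
    e≡3+2b = proj₂ (¬2∣∧1<⇒3+2b 2∤e 1<e)
    regroup : ∀ b d → (3 ℕ.+ b ℕ.* 2) ℕ.* d ≡ d ℕ.* (2 ℕ.+ b ℕ.+ (1 ℕ.+ b))
    regroup = ℕ-solve

theorem22 : (n : ℕ) → n ≥ 9 → ¬ Prime n →
    Σ (Graph n) λ G → IsNut G × TwoOrbits G
theorem22 n 9≤n ¬prime with 3 ∣? n | 2 ∣? n
... | yes (divides q refl) | _                    = clique-ring q (ℕP.*-cancelʳ-≤ 3 q 3 9≤n) 0 (inj₂ refl)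
... | no 3∤n               | yes (divides k refl) = skew-antiprism k (ℕP.*-cancelʳ-< 2 4 k 9≤n) (3∤n ∘ ∣m⇒∣m*n 2)
... | no _                 | no 2∤n
  with d , b , 3≤d , 2∤d , refl ← odd-composite-factorisation 9≤n ¬prime 2∤n = clique-ring d 3≤d b (inj₁ 2∤d)
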